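{- Let $1 \le \delta \le \Delta$ be integers and let $\tilde h:\mathbb{Z}^+\to\mathbb{R}^+$ be a positive non-decreasing function, with $\mathcal{J}(G)=\sum_{u\in V(G)}\tilde h(d_u)$. If $G\in\mathcal{G}_{\delta,\Delta}$, then $G$ is minimal for $\mathcal{J}$. Consequently, every graph $\Gamma$ with minimum degree $\delta$ and maximum degree $\Delta$ satisfies $$\mathcal{J}(\Gamma)\ge \Delta\tilde h(\delta)+\tilde h(\Delta)\quad\text{if }\Delta(\delta+1)\text{ is even},$$ $$\mathcal{J}(\Gamma)\ge (\Delta-1)\tilde h(\delta)+\tilde h(\delta+1)+\tilde h(\Delta)\quad\text{if }\Delta(\delta+1)\text{ is odd}.$$ Moreover, if either $\Delta(\delta+1)$ is even and $\tilde h(\delta)<\tilde h(\delta+1)$, or $\Delta(\delta+1)$ is odd and $\tilde h(\delta)<\tilde h(\delta+1)<\tilde h(\delta+2)$, then a graph $G$ with minimum degree $\delta$ and maximum degree $\Delta$ is minimal for $\mathcal{J}$ if and only if $G\in\mathcal{G}_{\delta,\Delta}$.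
   Context: All graphs are finite, simple (no loops or multiple edges) and have at least one edge; $d_u$ denotes the degree of vertex $u$. A graph $G$ with minimum degree $\delta$ and maximum degree $\Delta$ is called minimal for $\mathcal{J}$ if $\mathcal{J}(G)\le\mathcal{J}(\Gamma)$ for every graph $\Gamma$ with minimum degree $\delta$ and maximum degree $\Delta$. For integers $1\le\delta\le\Delta$, $\mathcal{G}_{\delta,\Delta}$ is the set of graphs $G$ with minimum degree $\delta$ and maximum degree $\Delta$ such that: (1) $G$ is the complete graph $K_{\Delta+1}$ if $\delta=\Delta$; (2) $|V(G)|=\Delta+1$ and there are $\Delta$ vertices of degree $\delta$, if $\delta<\Delta$ and $\Delta(\delta+1)$ is even; (3) $|V(G)|=\Delta+1$ and there are $\Delta-1$ vertices of degree $\delta$ and one vertex of degree $\delta+1$, if $\delta<\Delta-1$ and $\Delta(\delta+1)$ is odd; (4) $|V(G)|=\Delta+1$ and there are $\Delta-1$ vertices of degree $\delta$ and two vertices of degree $\Delta$, if $\delta=\Delta-1$ and $\Delta$ is odd. -}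

module Defs where

open import Level using (0ℓ)
open import Data.Nat as ℕ using (ℕ; zero; suc)
open import Data.Nat.Divisibility using (_∣_)
open import Data.Bool using (Bool; true; false)
open import Data.Fin using (Fin)
open import Data.List using (List; length; filter; map; foldr)
open import Data.List.Base using (allFin)
open import Data.Product using (_×_; ∃-syntax)
open import Data.Sum using (_⊎_)
open import Relation.Nullary using (¬_)
open import Relation.Binary.PropositionalEquality using (_≡_; _≢_)
open import Relation.Binary.Structures using (IsTotalOrder)
open import Algebra.Structures using (IsAbelianGroup)

-- Codomain of the weight function h̃.
-- The paper uses ℝ; agda-stdlib has no reals, so we quantify over an
-- arbitrary totally ordered abelian group (ℝ with + and ≤ is one).

record OrderedAbelianGroup : Set₁ where
  infixl 6 _+_
  infix 4 _≤_ _<_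
  field
    Carrier  : Set
    _+_      : Carrier → Carrier → Carrier
    0#       : Carrier
    -_       : Carrier → Carrier
    _≤_      : Carrier → Carrier → Set
    isAbelianGroup : IsAbelianGroup _≡_ _+_ 0# -_
    isTotalOrder   : IsTotalOrder _≡_ _≤_
    +-mono-≤ : ∀ {x y} z → x ≤ y → x + z ≤ y + z

  _<_ : Carrier → Carrier → Set
  x < y = x ≤ y × x ≢ y

  _·_ : ℕ → Carrier → Carrier
  zero  · x = 0#
  suc n · x = x + n · x

  ∑ : List Carrier → Carrier
  ∑ = foldr _+_ 0#

record Graph : Set where
  field
    n      : ℕ
    adj    : Fin n → Fin n → Bool
    sym    : ∀ u v → adj u v ≡ adj v u
    irrefl : ∀ u → adj u u ≡ false

open Graph public

vertices : (G : Graph) → List (Fin (n G))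
vertices G = allFin (n G)

deg : (G : Graph) → Fin (n G) → ℕ
deg G u = length (filter (λ v → adj G u v Data.Bool.≟ true) (vertices G))

countDeg : (G : Graph) → ℕ → ℕ
countDeg G k = length (filter (λ u → deg G u ℕ.≟ k) (vertices G))

HasMinMax : ℕ → ℕ → Graph → Set
HasMinMax δ Δ G =
  (∀ u → δ ℕ.≤ deg G u × deg G u ℕ.≤ Δ) ×
  (∃[ u ] deg G u ≡ δ) × (∃[ u ] deg G u ≡ Δ)

IsComplete : Graph → Set
IsComplete G = ∀ u v → u ≢ v → adj G u v ≡ true

InClass : ℕ → ℕ → Graph → Set
InClass δ Δ G =
  HasMinMax δ Δ G ×
  ( (δ ≡ Δ × n G ≡ suc Δ × IsComplete G)
  ⊎ (δ ℕ.< Δ × 2 ∣ Δ ℕ.* suc δ × n G ≡ suc Δ × countDeg G δ ≡ Δ)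
  ⊎ (suc δ ℕ.< Δ × ¬ (2 ∣ Δ ℕ.* suc δ) × n G ≡ suc Δ
       × countDeg G δ ≡ Δ ℕ.∸ 1 × countDeg G (suc δ) ≡ 1)
  ⊎ (suc δ ≡ Δ × ¬ (2 ∣ Δ) × n G ≡ suc Δ
       × countDeg G δ ≡ Δ ℕ.∸ 1 × countDeg G Δ ≡ 2) )

module _ (R : OrderedAbelianGroup) where
  open OrderedAbelianGroup R

  𝒥 : (ℕ → Carrier) → Graph → Carrier
  𝒥 h G = ∑ (map (λ u → h (deg G u)) (vertices G))

  Minimal : (ℕ → Carrier) → ℕ → ℕ → Graph → Set
  Minimal h δ Δ G =
    HasMinMax δ Δ G × (∀ Γ → HasMinMax δ Δ Γ → 𝒥 h G ≤ 𝒥 h Γ)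

-- 𝒥 depends only on the degree sequence. A vertex of degree Δ has Δ neighbours, so besides it
-- there are at least Δ vertices, each of weight at least h̃(δ): 𝒥 ≥ Δ h̃(δ) + h̃(Δ). If Δ(δ+1) is
-- odd then δ is even and Δ is odd, and by the handshake lemma these vertices cannot all have
-- degree δ, so one of them weighs at least h̃(δ+1). The graphs of 𝒢_{δ,Δ} are exactly those whose
-- degree sequence attains the bound, hence they are minimal. Under the strict monotonicity
-- hypotheses only those degree sequences attain it, so a minimal graph lies in 𝒢_{δ,Δ} as soon
-- as the bound is attained at all; it is, by a vertex joined to a circulant graph on Δ vertices
-- with degrees δ − 1 (one of them δ when Δ(δ+1) is odd).

module Submission where

open import Defs hiding (sym)
open import Level using (0ℓ)
open import Algebra.Bundles using (CommutativeMonoid)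
import Algebra.Properties.CommutativeMonoid.Sum as MonoidSum
open import Algebra.Structures using (IsAbelianGroup)
open import Data.Bool as Bool using (Bool; true; false; if_then_else_; _∧_; _∨_; not)
open import Data.Empty using (⊥-elim)
open import Data.Fin as Fin using (Fin; zero; suc; toℕ; punchIn; punchOut)
open import Data.Fin.Properties
  using (punchInᵢ≢i; punchIn-punchOut; punchIn-injective; toℕ<n; toℕ-fromℕ; toℕ-injective; all?; ¬∀⟶∃¬)
open import Data.List using (filter; length; tabulate)
open import Data.List.Properties using (map-tabulate)
open import Data.Nat as ℕ using (ℕ; zero; suc; _*_; _∸_; z≤n; s≤s; _≟_)
open import Data.Nat.Divisibility
  using (_∣_; _∣?_; divides; ∣-refl; ∣m∣n⇒∣m+n; ∣m+n∣m⇒∣n; ∣1⇒≡1; ∣m⇒∣m*n; ∣n⇒∣m*n)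
open import Data.Nat.Primality using (euclidsLemma; prime[2])
open import Data.Nat.Properties as ℕₚ using (+-0-commutativeMonoid)
open import Data.Nat.Tactic.RingSolver using (solve-∀)
open import Data.Product using (Σ-syntax; _×_; _,_; proj₁; proj₂; ∃-syntax; map₂)
open import Data.Sum using (_⊎_; inj₁; inj₂)
open import Data.Vec.Functional using (Vector; replicate)
open import Function using (_∘_; id)
open import Function.Bundles using (_⇔_; mk⇔)
open import Relation.Binary.Bundles using (Poset)
open import Relation.Binary.PropositionalEquality
  using (_≡_; _≢_; refl; sym; trans; cong; cong₂; subst; subst₂; module ≡-Reasoning)
open import Relation.Binary.Structures using (IsTotalOrder)
open import Relation.Nullary using (¬_; Dec; yes; no; does)
open import Relation.Nullary.Decidable using (dec-true; dec-false; does-⇔)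
open import Relation.Unary using (Pred; Decidable)

punchIn-onto : ∀ {m} (u : Fin (suc m)) {v} → v ≢ u → ∃[ j ] punchIn u j ≡ v
punchIn-onto u v≢u = punchOut (v≢u ∘ sym) , punchIn-punchOut (v≢u ∘ sym)

punchIn₂ : ∀ {m} {u₀ u₁ : Fin (suc (suc m))} → u₁ ≢ u₀ → Fin m → Fin (suc (suc m))
punchIn₂ {u₀ = u₀} u₁≢u₀ = punchIn u₀ ∘ punchIn (punchOut (u₁≢u₀ ∘ sym))

punchIn₂≢u₀ : ∀ {m} {u₀ u₁ : Fin (suc (suc m))} (u₁≢u₀ : u₁ ≢ u₀) k → punchIn₂ u₁≢u₀ k ≢ u₀
punchIn₂≢u₀ {u₀ = u₀} u₁≢u₀ k = punchInᵢ≢i u₀ (punchIn (punchOut (u₁≢u₀ ∘ sym)) k)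

punchIn₂≢u₁ : ∀ {m} {u₀ u₁ : Fin (suc (suc m))} (u₁≢u₀ : u₁ ≢ u₀) k → punchIn₂ u₁≢u₀ k ≢ u₁
punchIn₂≢u₁ {u₀ = u₀} u₁≢u₀ k eq =
  punchInᵢ≢i (punchOut (u₁≢u₀ ∘ sym)) k
    (punchIn-injective u₀ _ _ (trans eq (sym (punchIn-punchOut (u₁≢u₀ ∘ sym)))))

punchIn₂-onto : ∀ {m} {u₀ u₁ : Fin (suc (suc m))} (u₁≢u₀ : u₁ ≢ u₀) {v} → v ≢ u₀ → v ≢ u₁ →
                ∃[ k ] punchIn₂ u₁≢u₀ k ≡ v
punchIn₂-onto {u₀ = u₀} u₁≢u₀ v≢u₀ v≢u₁
  with j , refl ← punchIn-onto u₀ v≢u₀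
  with k , refl ← punchIn-onto (punchOut (u₁≢u₀ ∘ sym)) {j} (λ { refl → v≢u₁ (punchIn-punchOut (u₁≢u₀ ∘ sym)) })
  = k , refl

-- Degree sequences of the graphs in cases (1)–(2), resp. (3)–(4), of 𝒢_{δ,Δ}.

EvenExtremal : ℕ → ℕ → ∀ {N} → (Fin N → ℕ) → Set
EvenExtremal δ Δ {N} d = N ≡ suc Δ × Σ[ u₀ ∈ Fin N ] d u₀ ≡ Δ × (∀ v → v ≢ u₀ → d v ≡ δ)

OddExtremal : ℕ → ℕ → ∀ {N} → (Fin N → ℕ) → Set
OddExtremal δ Δ {N} d =
  N ≡ suc Δ × Σ[ u₀ ∈ Fin N ] Σ[ u₁ ∈ Fin N ]
    u₁ ≢ u₀ × d u₀ ≡ Δ × d u₁ ≡ suc δ × (∀ v → v ≢ u₀ → v ≢ u₁ → d v ≡ δ)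

Extremal : ℕ → ℕ → ∀ {N} → (Fin N → ℕ) → Set
Extremal δ Δ d = (2 ∣ Δ * suc δ × EvenExtremal δ Δ d) ⊎ (¬ 2 ∣ Δ * suc δ × OddExtremal δ Δ d)

module ExtremalSums {c ℓ} (M : CommutativeMonoid c ℓ) where
  open CommutativeMonoid M using (Carrier; _≈_; setoid; rawMonoid) renaming (_∙_ to _+_; ∙-congˡ to +-congˡ)
  open import Algebra.Definitions.RawMonoid rawMonoid using () renaming (_×_ to _·_)
  open MonoidSum M using (sum; sum-remove; sum-cong-≗; sum-replicate)
  open import Relation.Binary.Reasoning.Setoid setoid

  sum-remove₂ : ∀ {m} (f : Vector Carrier (suc (suc m))) {u₀ u₁} (u₁≢u₀ : u₁ ≢ u₀) →
                sum f ≈ f u₀ + (f u₁ + sum (f ∘ punchIn₂ u₁≢u₀))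
  sum-remove₂ f {u₀} {u₁} u₁≢u₀ = begin
    sum f                                                ≈⟨ sum-remove {i = u₀} f ⟩
    f u₀ + sum (f ∘ punchIn u₀)                          ≈⟨ +-congˡ (sum-remove {i = w} (f ∘ punchIn u₀)) ⟩
    f u₀ + (f (punchIn u₀ w) + sum (f ∘ punchIn₂ u₁≢u₀)) ≡⟨ cong (λ x → f u₀ + (f x + sum (f ∘ punchIn₂ u₁≢u₀)))
                                                                 (punchIn-punchOut (u₁≢u₀ ∘ sym)) ⟩
    f u₀ + (f u₁ + sum (f ∘ punchIn₂ u₁≢u₀))             ∎
    where w = punchOut (u₁≢u₀ ∘ sym)

  sum-EvenExtremal : ∀ {δ Δ N} {d : Fin N → ℕ} (f : ℕ → Carrier) → EvenExtremal δ Δ d →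
                     sum (f ∘ d) ≈ f Δ + Δ · f δ
  sum-EvenExtremal {δ} {Δ} {d = d} f (refl , u₀ , d₀ , others) = begin
    sum (f ∘ d)                          ≈⟨ sum-remove {i = u₀} (f ∘ d) ⟩
    f (d u₀) + sum (f ∘ d ∘ punchIn u₀)  ≡⟨ cong₂ _+_ (cong f d₀)
                                              (sum-cong-≗ λ j → cong f (others (punchIn u₀ j) (punchInᵢ≢i u₀ j))) ⟩
    f Δ + sum (replicate Δ (f δ))        ≈⟨ +-congˡ (sum-replicate Δ) ⟩
    f Δ + Δ · f δ                        ∎

  sum-OddExtremal : ∀ {δ Δ N} {d : Fin N → ℕ} (f : ℕ → Carrier) → OddExtremal δ Δ d →
                    sum (f ∘ d) ≈ f Δ + (f (suc δ) + (Δ ∸ 1) · f δ)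
  sum-OddExtremal {Δ = zero} f (refl , zero , zero , u₁≢u₀ , _) = ⊥-elim (u₁≢u₀ refl)
  sum-OddExtremal {δ} {suc Δ} {d = d} f (refl , u₀ , u₁ , u₁≢u₀ , d₀ , d₁ , others) = begin
    sum (f ∘ d)                                           ≈⟨ sum-remove₂ (f ∘ d) u₁≢u₀ ⟩
    f (d u₀) + (f (d u₁) + sum (f ∘ d ∘ punchIn₂ u₁≢u₀))
      ≡⟨ cong₂ _+_ (cong f d₀) (cong₂ _+_ (cong f d₁) (sum-cong-≗ λ k →
           cong f (others _ (punchIn₂≢u₀ u₁≢u₀ k) (punchIn₂≢u₁ u₁≢u₀ k)))) ⟩
    f (suc Δ) + (f (suc δ) + sum (replicate Δ (f δ)))     ≈⟨ +-congˡ (+-congˡ (sum-replicate Δ)) ⟩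
    f (suc Δ) + (f (suc δ) + Δ · f δ)                     ∎

bit : Bool → ℕ
bit b = if b then 1 else 0

does≡true⇒ : ∀ {a} {A : Set a} (a? : Dec A) → does a? ≡ true → A
does≡true⇒ (yes a) _ = a

does-≟true : ∀ b → does (b Bool.≟ true) ≡ b
does-≟true true  = refl
does-≟true false = refl

module _ where
  open import Data.Nat using (_+_; _≤_; _<_; _≤?_; _⊓_; ∣_-_∣)
  open import Algebra.Properties.CommutativeSemigroup ℕₚ.+-commutativeSemigroup using (interchange)
  open MonoidSum +-0-commutativeMonoid using (sum; sum-remove; sum-cong-≗; sum-replicate; ∑-distrib-+)
  open ExtremalSums +-0-commutativeMonoid using (sum-remove₂; sum-EvenExtremal; sum-OddExtremal)
  open import Algebra.Definitions.RawMonoid (CommutativeMonoid.rawMonoid +-0-commutativeMonoid)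
    using () renaming (_×_ to _·_)

  ·≡* : ∀ m x → m · x ≡ m * x
  ·≡* zero    x = refl
  ·≡* (suc m) x = cong (x +_) (·≡* m x)

  bit≡1 : ∀ {x k} → x ≡ k → bit (does (x ≟ k)) ≡ 1
  bit≡1 {x} {k} x≡k = cong bit (dec-true (x ≟ k) x≡k)

  bit≡0 : ∀ {x k} → x ≢ k → bit (does (x ≟ k)) ≡ 0
  bit≡0 {x} {k} x≢k = cong bit (dec-false (x ≟ k) x≢k)

  halve : ∀ n → ∃[ t ] (n ≡ t + t ⊎ n ≡ suc (t + t))
  halve zero = 0 , inj₁ refl
  halve (suc n) with halve n
  ... | t , inj₁ refl = t , inj₂ refl
  ... | t , inj₂ refl = suc t , inj₁ (cong suc (sym (ℕₚ.+-suc t t)))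

  2∣n+n : ∀ n → 2 ∣ n + n
  2∣n+n n = divides n (trans (cong (n +_) (sym (ℕₚ.+-identityʳ n))) (ℕₚ.*-comm 2 n))

  2∣2+n+n : ∀ n → 2 ∣ suc (suc (n + n))
  2∣2+n+n n = ∣m∣n⇒∣m+n ∣-refl (2∣n+n n)

  2∣n⊎2∣1+n : ∀ n → 2 ∣ n ⊎ 2 ∣ suc n
  2∣n⊎2∣1+n n with halve n
  ... | t , inj₁ refl = inj₁ (2∣n+n t)
  ... | t , inj₂ refl = inj₂ (2∣2+n+n t)

  2∣n⇒2∤1+n : ∀ {n} → 2 ∣ n → ¬ 2 ∣ suc n
  2∣n⇒2∤1+n {n} 2∣n 2∣1+n with () ← ∣1⇒≡1 (∣m+n∣m⇒∣n (subst (2 ∣_) (ℕₚ.+-comm 1 n) 2∣1+n) 2∣n)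

  2∣n*[1+n] : ∀ n → 2 ∣ n * suc n
  2∣n*[1+n] n with 2∣n⊎2∣1+n n
  ... | inj₁ 2∣n   = ∣m⇒∣m*n (suc n) 2∣n
  ... | inj₂ 2∣1+n = ∣n⇒∣m*n n 2∣1+n

  2∤m*[1+n]⇒2∤m : ∀ m n → ¬ 2 ∣ m * suc n → ¬ 2 ∣ m
  2∤m*[1+n]⇒2∤m m n 2∤ 2∣m = 2∤ (∣m⇒∣m*n (suc n) 2∣m)

  2∤m*[1+n]⇒2∣n : ∀ m n → ¬ 2 ∣ m * suc n → 2 ∣ n
  2∤m*[1+n]⇒2∣n m n 2∤ with 2∣n⊎2∣1+n n
  ... | inj₁ 2∣n   = 2∣n
  ... | inj₂ 2∣1+n = ⊥-elim (2∤ (∣n⇒∣m*n m 2∣1+n))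

  2∤m*[1+n]⇒n≢m : ∀ {m n} → ¬ 2 ∣ m * suc n → n ≢ m
  2∤m*[1+n]⇒n≢m {m} 2∤ refl = 2∤ (2∣n*[1+n] m)

  2∤m⇒2∤n⇒2∤m*n : ∀ m n → ¬ 2 ∣ m → ¬ 2 ∣ n → ¬ 2 ∣ m * n
  2∤m⇒2∤n⇒2∤m*n m n 2∤m 2∤n 2∣m*n with euclidsLemma m n prime[2] 2∣m*n
  ... | inj₁ 2∣m = 2∤m 2∣m
  ... | inj₂ 2∣n = 2∤n 2∣n

  length-filter-tabulate : ∀ {a p} {A : Set a} {P : Pred A p} (P? : Decidable P) {n} (f : Fin n → A) →
                           length (filter P? (tabulate f)) ≡ sum (λ i → bit (does (P? (f i))))
  length-filter-tabulate P? {zero}  f = refl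
  length-filter-tabulate P? {suc n} f with does (P? (f zero))
  ... | true  = cong suc (length-filter-tabulate P? (f ∘ suc))
  ... | false = length-filter-tabulate P? (f ∘ suc)

  sum-bits≤size : ∀ {m} (p : Vector Bool m) → sum (bit ∘ p) ≤ m
  sum-bits≤size {zero}  p = z≤n
  sum-bits≤size {suc m} p = ℕₚ.+-mono-≤ (bit≤1 (p zero)) (sum-bits≤size (p ∘ suc))
    where
    bit≤1 : ∀ b → bit b ≤ 1
    bit≤1 true  = s≤s z≤n
    bit≤1 false = z≤n

  sum-bits≡size⇒all : ∀ {m} (p : Vector Bool m) → sum (bit ∘ p) ≡ m → ∀ i → p i ≡ true
  sum-bits≡size⇒all {suc m} p eq i with p zero in p₀
  ... | false = ⊥-elim (ℕₚ.<-irrefl eq (s≤s (sum-bits≤size (p ∘ suc))))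
  sum-bits≡size⇒all {suc m} p eq zero    | true = p₀
  sum-bits≡size⇒all {suc m} p eq (suc i) | true = sum-bits≡size⇒all (p ∘ suc) (ℕₚ.suc-injective eq) i

  all⇒sum-bits≡size : ∀ {m} (p : Vector Bool m) → (∀ i → p i ≡ true) → sum (bit ∘ p) ≡ m
  all⇒sum-bits≡size {zero}  p all = refl
  all⇒sum-bits≡size {suc m} p all rewrite all zero = cong suc (all⇒sum-bits≡size (p ∘ suc) (all ∘ suc))

  sum-bits-positive⇒∃ : ∀ {m} (p : Vector Bool m) → 0 < sum (bit ∘ p) → ∃[ i ] p i ≡ true
  sum-bits-positive⇒∃ {suc m} p positive with p zero in p₀
  ... | true  = zero , p₀
  ... | false = let i , pᵢ = sum-bits-positive⇒∃ (p ∘ suc) positive in suc i , pᵢ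

  sum-bits-remove : ∀ {m} (p : Vector Bool (suc m)) u → sum (bit ∘ p) ≡ bit (p u) + sum (bit ∘ p ∘ punchIn u)
  sum-bits-remove p u = sum-remove {i = u} (bit ∘ p)

  sum-bits-remove-false : ∀ {m} (p : Vector Bool (suc m)) {u} → p u ≡ false →
                          sum (bit ∘ p) ≡ sum (bit ∘ p ∘ punchIn u)
  sum-bits-remove-false p {u} pᵤ = trans (sum-bits-remove p u) (cong (λ b → bit b + sum (bit ∘ p ∘ punchIn u)) pᵤ)

  bit<sum-bits⇒∃other : ∀ {N} (p : Vector Bool N) u₀ → bit (p u₀) < sum (bit ∘ p) → ∃[ u₁ ] u₁ ≢ u₀ × p u₁ ≡ true
  bit<sum-bits⇒∃other {suc m} p u₀ bit<sum =
    let j , pⱼ = sum-bits-positive⇒∃ (p ∘ punchIn u₀) rest-positive in punchIn u₀ j , punchInᵢ≢i u₀ j , pⱼ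
    where
    rest-positive : 0 < sum (bit ∘ p ∘ punchIn u₀)
    rest-positive = ℕₚ.+-cancelˡ-< (bit (p u₀)) 0 _
      (subst₂ _<_ (sym (ℕₚ.+-identityʳ (bit (p u₀)))) (sum-bits-remove p u₀) bit<sum)

  sum-bits<size : ∀ {N} (p : Vector Bool N) {u} → p u ≡ false → sum (bit ∘ p) < N
  sum-bits<size {suc m} p {u} pᵤ = begin-strict
    sum (bit ∘ p)                          ≡⟨ sum-bits-remove-false p pᵤ ⟩
    sum (bit ∘ p ∘ punchIn u)              ≤⟨ sum-bits≤size (p ∘ punchIn u) ⟩
    m                                      <⟨ ℕₚ.n<1+n m ⟩
    suc m                                  ∎
    where open ℕₚ.≤-Reasoning

  sum-bits≡size∸1⇒others : ∀ {N} (p : Vector Bool N) {u} → p u ≡ false → sum (bit ∘ p) ≡ N ∸ 1 →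
                           ∀ v → v ≢ u → p v ≡ true
  sum-bits≡size∸1⇒others {suc m} p {u} pᵤ eq v v≢u with j , refl ← punchIn-onto u v≢u =
    sum-bits≡size⇒all (p ∘ punchIn u) (trans (sym (sum-bits-remove-false p pᵤ)) eq) j

  others⇒sum-bits≡size∸1 : ∀ {N} (p : Vector Bool N) {u} → p u ≡ false → (∀ v → v ≢ u → p v ≡ true) →
                           sum (bit ∘ p) ≡ N ∸ 1
  others⇒sum-bits≡size∸1 {suc m} p {u} pᵤ others =
    trans (sum-bits-remove-false p pᵤ) (all⇒sum-bits≡size (p ∘ punchIn u) λ j → others (punchIn u j) (punchInᵢ≢i u j))

  sum-bits≡size∸2⇒others : ∀ {N} (p : Vector Bool N) {u₀ u₁} → u₁ ≢ u₀ → p u₀ ≡ false → p u₁ ≡ false →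
                           sum (bit ∘ p) ≡ N ∸ 2 → ∀ v → v ≢ u₀ → v ≢ u₁ → p v ≡ true
  sum-bits≡size∸2⇒others {suc zero}    p {zero} {zero} u₁≢u₀ = ⊥-elim (u₁≢u₀ refl)
  sum-bits≡size∸2⇒others {suc (suc m)} p u₁≢u₀ p₀ p₁ eq v v≢u₀ v≢u₁
    with k , refl ← punchIn₂-onto u₁≢u₀ v≢u₀ v≢u₁ =
    sum-bits≡size⇒all (p ∘ punchIn₂ u₁≢u₀)
      (trans (sym (trans (sum-remove₂ (bit ∘ p) u₁≢u₀)
                         (cong₂ (λ b c → bit b + (bit c + sum (bit ∘ p ∘ punchIn₂ u₁≢u₀))) p₀ p₁))) eq) k

  -- Degrees

  handshake-sum : ∀ {N} (a : Fin N → Fin N → Bool) → (∀ u v → a u v ≡ a v u) → (∀ u → a u u ≡ false) →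
                  2 ∣ sum (λ u → sum (bit ∘ a u))
  handshake-sum {zero}  a a-sym a-irrefl = divides 0 refl
  handshake-sum {suc N} a a-sym a-irrefl =
    subst (2 ∣_) (sym row₀-twice)
      (∣m∣n⇒∣m+n (2∣n+n R) (handshake-sum a′ (λ u v → a-sym (suc u) (suc v)) (a-irrefl ∘ suc)))
    where
    open ≡-Reasoning
    a′ = λ u v → a (suc u) (suc v)
    R = sum (λ v → bit (a zero (suc v)))
    S = sum (λ u → sum (bit ∘ a′ u))
    row₀-twice : sum (λ u → sum (bit ∘ a u)) ≡ (R + R) + S
    row₀-twice = begin
      bit (a zero zero) + R + sum (λ u → bit (a (suc u) zero) + sum (bit ∘ a′ u))
        ≡⟨ cong₂ (λ b x → bit b + R + x) (a-irrefl zero)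
                 (∑-distrib-+ (λ u → bit (a (suc u) zero)) (λ u → sum (bit ∘ a′ u))) ⟩
      R + (sum (λ u → bit (a (suc u) zero)) + S)
        ≡⟨ cong (λ x → R + (x + S)) (sum-cong-≗ λ u → cong bit (a-sym (suc u) zero)) ⟩
      R + (R + S)
        ≡⟨ ℕₚ.+-assoc R R S ⟨
      R + R + S ∎

  deg≡sum : ∀ G u → deg G u ≡ sum (bit ∘ adj G u)
  deg≡sum G u = trans (length-filter-tabulate (λ v → adj G u v Bool.≟ true) id)
                      (sum-cong-≗ λ v → cong bit (does-≟true (adj G u v)))

  countDeg≡sum : ∀ G k → countDeg G k ≡ sum (λ u → bit (does (deg G u ≟ k)))
  countDeg≡sum G k = length-filter-tabulate (λ u → deg G u ≟ k) id

  deg<n : ∀ G u → deg G u < n G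
  deg<n G u = subst (_< n G) (sym (deg≡sum G u)) (sum-bits<size (adj G u) (irrefl G u))

  handshake : ∀ G → 2 ∣ sum (deg G)
  handshake G = subst (2 ∣_) (sym (sum-cong-≗ (deg≡sum G))) (handshake-sum (adj G) (Graph.sym G) (irrefl G))

  complete⇒deg≡n∸1 : ∀ G → IsComplete G → ∀ u → deg G u ≡ n G ∸ 1
  complete⇒deg≡n∸1 G complete u = trans (deg≡sum G u)
    (others⇒sum-bits≡size∸1 (adj G u) (irrefl G u) λ v v≢u → complete u v (v≢u ∘ sym))

  deg≡n∸1⇒complete : ∀ G → (∀ u → deg G u ≡ n G ∸ 1) → IsComplete G
  deg≡n∸1⇒complete G full u v u≢v =
    sum-bits≡size∸1⇒others (adj G u) (irrefl G u) (trans (sym (deg≡sum G u)) (full u)) v (u≢v ∘ sym)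

  countDeg≡n∸1⇒others : ∀ G {k u₀} → deg G u₀ ≢ k → countDeg G k ≡ n G ∸ 1 → ∀ v → v ≢ u₀ → deg G v ≡ k
  countDeg≡n∸1⇒others G {k} {u₀} d₀≢k count v v≢u₀ =
    does≡true⇒ (deg G v ≟ k) (sum-bits≡size∸1⇒others (λ u → does (deg G u ≟ k)) (dec-false (deg G u₀ ≟ k) d₀≢k)
                                 (trans (sym (countDeg≡sum G k)) count) v v≢u₀)

  countDeg≡n∸2⇒others : ∀ G {k u₀ u₁} → u₁ ≢ u₀ → deg G u₀ ≢ k → deg G u₁ ≢ k → countDeg G k ≡ n G ∸ 2 →
                        ∀ v → v ≢ u₀ → v ≢ u₁ → deg G v ≡ k
  countDeg≡n∸2⇒others G {k} {u₀} {u₁} u₁≢u₀ d₀≢k d₁≢k count v v≢u₀ v≢u₁ =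
    does≡true⇒ (deg G v ≟ k) (sum-bits≡size∸2⇒others (λ u → does (deg G u ≟ k)) u₁≢u₀
                                 (dec-false (deg G u₀ ≟ k) d₀≢k) (dec-false (deg G u₁ ≟ k) d₁≢k)
                                 (trans (sym (countDeg≡sum G k)) count) v v≢u₀ v≢u₁)

  bit<countDeg⇒∃other : ∀ G {k} u₀ → bit (does (deg G u₀ ≟ k)) < countDeg G k → ∃[ u₁ ] u₁ ≢ u₀ × deg G u₁ ≡ k
  bit<countDeg⇒∃other G {k} u₀ bit<count =
    let u₁ , u₁≢u₀ , p₁ = bit<sum-bits⇒∃other (λ u → does (deg G u ≟ k)) u₀
                            (subst (bit (does (deg G u₀ ≟ k)) <_) (countDeg≡sum G k) bit<count)
    in u₁ , u₁≢u₀ , does≡true⇒ (deg G u₁ ≟ k) p₁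

  countDeg-EvenExtremal : ∀ {δ Δ} G k → EvenExtremal δ Δ (deg G) →
                          countDeg G k ≡ bit (does (Δ ≟ k)) + Δ * bit (does (δ ≟ k))
  countDeg-EvenExtremal {Δ = Δ} G k even =
    trans (countDeg≡sum G k) (trans (sum-EvenExtremal (λ x → bit (does (x ≟ k))) even)
                                    (cong (bit (does (Δ ≟ k)) +_) (·≡* Δ _)))

  countDeg-OddExtremal : ∀ {δ Δ} G k → OddExtremal δ Δ (deg G) →
                         countDeg G k ≡ bit (does (Δ ≟ k)) + (bit (does (suc δ ≟ k)) + (Δ ∸ 1) * bit (does (δ ≟ k)))
  countDeg-OddExtremal {δ} {Δ} G k odd =
    trans (countDeg≡sum G k) (trans (sum-OddExtremal (λ x → bit (does (x ≟ k))) odd)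
                                    (cong (λ x → bit (does (Δ ≟ k)) + (bit (does (suc δ ≟ k)) + x)) (·≡* (Δ ∸ 1) _)))

  -- Otherwise the degree sum would be Δ + (N − 1)δ, which is odd since Δ is odd and δ even.
  second-large-degree : ∀ {N δ Δ} (d : Fin N → ℕ) {u₀} → (∀ v → δ ≤ d v) → d u₀ ≡ Δ → 2 ∣ sum d →
                        ¬ 2 ∣ Δ * suc δ → ∃[ u₁ ] u₁ ≢ u₀ × suc δ ≤ d u₁
  second-large-degree {suc m} {δ} {Δ} d {u₀} δ≤d d₀ 2∣sum 2∤ with all? (λ j → d (punchIn u₀ j) ≟ δ)
  ... | no ¬all =
    let j , dⱼ≢δ = ¬∀⟶∃¬ m _ (λ j → d (punchIn u₀ j) ≟ δ) ¬all
    in punchIn u₀ j , punchInᵢ≢i u₀ j , ℕₚ.≤∧≢⇒< (δ≤d _) (dⱼ≢δ ∘ sym)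
  ... | yes rest≡δ = ⊥-elim (2∤m*[1+n]⇒2∤m Δ δ 2∤ 2∣Δ)
    where
    open ≡-Reasoning
    sum≡ : sum d ≡ Δ + m * δ
    sum≡ = begin
      sum d                          ≡⟨ sum-remove {i = u₀} d ⟩
      d u₀ + sum (d ∘ punchIn u₀)    ≡⟨ cong₂ _+_ d₀ (sum-cong-≗ rest≡δ) ⟩
      Δ + sum (replicate m δ)        ≡⟨ cong (Δ +_) (trans (sum-replicate m) (·≡* m δ)) ⟩
      Δ + m * δ                      ∎
    2∣Δ : 2 ∣ Δ
    2∣Δ = ∣m+n∣m⇒∣n (subst (2 ∣_) (trans sum≡ (ℕₚ.+-comm Δ (m * δ))) 2∣sum) (∣n⇒∣m*n m (2∤m*[1+n]⇒2∣n Δ δ 2∤))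

  counts⇒OddExtremal : ∀ {δ Δ} G {u₀ u₁} → n G ≡ suc Δ → δ < Δ → deg G u₀ ≡ Δ → u₁ ≢ u₀ → deg G u₁ ≡ suc δ →
                       countDeg G δ ≡ Δ ∸ 1 → OddExtremal δ Δ (deg G)
  counts⇒OddExtremal G {u₀} {u₁} n≡ δ<Δ d₀ u₁≢u₀ d₁ count =
    n≡ , u₀ , u₁ , u₁≢u₀ , d₀ , d₁ ,
    countDeg≡n∸2⇒others G u₁≢u₀ (λ d₀≡δ → ℕₚ.>⇒≢ δ<Δ (trans (sym d₀) d₀≡δ)) (λ d₁≡δ → ℕₚ.1+n≢n (trans (sym d₁) d₁≡δ))
      (trans count (cong (_∸ 2) (sym n≡)))

  InClass⇒Extremal : ∀ {δ Δ} G → InClass δ Δ G → Extremal δ Δ (deg G)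
  InClass⇒Extremal {Δ = Δ} G ((_ , _ , u₀ , d₀) , inj₁ (refl , n≡ , complete)) =
    inj₁ (2∣n*[1+n] Δ , n≡ , u₀ , d₀ , λ v _ → trans (complete⇒deg≡n∸1 G complete v) (cong (_∸ 1) n≡))
  InClass⇒Extremal G ((_ , _ , u₀ , d₀) , inj₂ (inj₁ (δ<Δ , 2∣ , n≡ , count))) =
    inj₁ (2∣ , n≡ , u₀ , d₀ ,
          countDeg≡n∸1⇒others G (λ d₀≡δ → ℕₚ.>⇒≢ δ<Δ (trans (sym d₀) d₀≡δ)) (trans count (cong (_∸ 1) (sym n≡))))
  InClass⇒Extremal {δ} G ((_ , _ , u₀ , d₀) , inj₂ (inj₂ (inj₁ (1+δ<Δ , 2∤ , n≡ , countδ , count1+δ)))) =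
    let u₁ , u₁≢u₀ , d₁ = bit<countDeg⇒∃other G u₀
                            (subst₂ _<_ (sym (bit≡0 λ d₀≡ → ℕₚ.>⇒≢ 1+δ<Δ (trans (sym d₀) d₀≡))) (sym count1+δ) (s≤s z≤n))
    in inj₂ (2∤ , counts⇒OddExtremal G n≡ (ℕₚ.<-trans (ℕₚ.n<1+n δ) 1+δ<Δ) d₀ u₁≢u₀ d₁ countδ)
  InClass⇒Extremal {δ} {Δ} G ((_ , _ , u₀ , d₀) , inj₂ (inj₂ (inj₂ (refl , 2∤Δ , n≡ , countδ , countΔ)))) =
    let u₁ , u₁≢u₀ , d₁ = bit<countDeg⇒∃other G u₀ (subst₂ _<_ (sym (bit≡1 d₀)) (sym countΔ) (s≤s (s≤s z≤n)))
    in inj₂ (2∤m⇒2∤n⇒2∤m*n Δ Δ 2∤Δ 2∤Δ , counts⇒OddExtremal G n≡ (ℕₚ.n<1+n δ) d₀ u₁≢u₀ d₁ countδ)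

  ∃-vertex≢ : ∀ {N} (u : Fin N) → 2 ≤ N → ∃[ v ] v ≢ u
  ∃-vertex≢ {suc zero}    zero (s≤s ())
  ∃-vertex≢ {suc (suc m)} u    _ = punchIn u zero , punchInᵢ≢i u zero

  ∃-vertex≢₂ : ∀ {N} {u₀ u₁ : Fin N} → 3 ≤ N → u₁ ≢ u₀ → ∃[ v ] v ≢ u₀ × v ≢ u₁
  ∃-vertex≢₂ {suc zero}          {zero} {zero} _ u₁≢u₀ = ⊥-elim (u₁≢u₀ refl)
  ∃-vertex≢₂ {suc (suc zero)}    (s≤s (s≤s ())) _
  ∃-vertex≢₂ {suc (suc (suc m))} _ u₁≢u₀ = punchIn₂ u₁≢u₀ zero , punchIn₂≢u₀ u₁≢u₀ zero , punchIn₂≢u₁ u₁≢u₀ zero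

  Extremal⇒HasMinMax : ∀ {δ Δ} G → 1 ≤ δ → δ ≤ Δ → Extremal δ Δ (deg G) → HasMinMax δ Δ G
  Extremal⇒HasMinMax {δ} {Δ} G 1≤δ δ≤Δ (inj₁ (_ , n≡ , u₀ , d₀ , others)) =
    bounds , (v , others v v≢u₀) , (u₀ , d₀)
    where
    bounds : ∀ u → δ ≤ deg G u × deg G u ≤ Δ
    bounds u with u Fin.≟ u₀
    ... | yes refl = subst (δ ≤_) (sym d₀) δ≤Δ , ℕₚ.≤-reflexive d₀
    ... | no u≢u₀  = ℕₚ.≤-reflexive (sym (others u u≢u₀)) , subst (_≤ Δ) (sym (others u u≢u₀)) δ≤Δ
    other = ∃-vertex≢ u₀ (subst (2 ≤_) (sym n≡) (s≤s (ℕₚ.≤-trans 1≤δ δ≤Δ)))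
    v = proj₁ other
    v≢u₀ = proj₂ other
  Extremal⇒HasMinMax {δ} {Δ} G 1≤δ δ≤Δ (inj₂ (2∤ , n≡ , u₀ , u₁ , u₁≢u₀ , d₀ , d₁ , others)) =
    bounds , (v , others v v≢u₀ v≢u₁) , (u₀ , d₀)
    where
    δ<Δ : δ < Δ
    δ<Δ = ℕₚ.≤∧≢⇒< δ≤Δ (2∤m*[1+n]⇒n≢m 2∤)
    bounds : ∀ u → δ ≤ deg G u × deg G u ≤ Δ
    bounds u with u Fin.≟ u₀ | u Fin.≟ u₁
    ... | yes refl | _        = subst (δ ≤_) (sym d₀) δ≤Δ , ℕₚ.≤-reflexive d₀
    ... | no _     | yes refl = subst (δ ≤_) (sym d₁) (ℕₚ.n≤1+n δ) , subst (_≤ Δ) (sym d₁) δ<Δ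
    ... | no u≢u₀  | no u≢u₁  =
      ℕₚ.≤-reflexive (sym (others u u≢u₀ u≢u₁)) , subst (_≤ Δ) (sym (others u u≢u₀ u≢u₁)) δ≤Δ
    third = ∃-vertex≢₂ (subst (3 ≤_) (sym n≡) (s≤s (ℕₚ.≤-trans (s≤s 1≤δ) δ<Δ))) u₁≢u₀
    v = proj₁ third
    v≢u₀ = proj₁ (proj₂ third)
    v≢u₁ = proj₂ (proj₂ third)

  EvenExtremal⇒countDeg : ∀ {δ Δ} G → δ ≢ Δ → EvenExtremal δ Δ (deg G) → countDeg G δ ≡ Δ
  EvenExtremal⇒countDeg {δ} {Δ} G δ≢Δ even = begin
    countDeg G δ                                  ≡⟨ countDeg-EvenExtremal G δ even ⟩
    bit (does (Δ ≟ δ)) + Δ * bit (does (δ ≟ δ))   ≡⟨ cong₂ (λ a b → a + Δ * b) (bit≡0 (δ≢Δ ∘ sym)) (bit≡1 {δ} refl) ⟩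
    Δ * 1                                         ≡⟨ ℕₚ.*-identityʳ Δ ⟩
    Δ                                             ∎
    where open ≡-Reasoning

  OddExtremal⇒countDeg : ∀ {δ Δ} G → δ < Δ → OddExtremal δ Δ (deg G) →
                         countDeg G δ ≡ Δ ∸ 1 × (suc δ < Δ → countDeg G (suc δ) ≡ 1) × (suc δ ≡ Δ → countDeg G Δ ≡ 2)
  OddExtremal⇒countDeg {δ} {Δ} G δ<Δ odd = countδ , count1+δ , countΔ
    where
    open ≡-Reasoning
    countδ : countDeg G δ ≡ Δ ∸ 1
    countδ = begin
      countDeg G δ
        ≡⟨ countDeg-OddExtremal G δ odd ⟩
      bit (does (Δ ≟ δ)) + (bit (does (suc δ ≟ δ)) + (Δ ∸ 1) * bit (does (δ ≟ δ)))
        ≡⟨ cong₂ _+_ (bit≡0 (ℕₚ.>⇒≢ δ<Δ)) (cong₂ (λ b c → b + (Δ ∸ 1) * c) (bit≡0 (ℕₚ.1+n≢n {δ})) (bit≡1 {δ} refl)) ⟩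
      (Δ ∸ 1) * 1
        ≡⟨ ℕₚ.*-identityʳ (Δ ∸ 1) ⟩
      Δ ∸ 1 ∎
    count1+δ : suc δ < Δ → countDeg G (suc δ) ≡ 1
    count1+δ 1+δ<Δ = begin
      countDeg G (suc δ)
        ≡⟨ countDeg-OddExtremal G (suc δ) odd ⟩
      bit (does (Δ ≟ suc δ)) + (bit (does (suc δ ≟ suc δ)) + (Δ ∸ 1) * bit (does (δ ≟ suc δ)))
        ≡⟨ cong₂ _+_ (bit≡0 (ℕₚ.>⇒≢ 1+δ<Δ))
                     (cong₂ (λ b c → b + (Δ ∸ 1) * c) (bit≡1 {suc δ} refl) (bit≡0 (ℕₚ.<⇒≢ (ℕₚ.n<1+n δ)))) ⟩
      1 + (Δ ∸ 1) * 0
        ≡⟨ cong suc (ℕₚ.*-zeroʳ (Δ ∸ 1)) ⟩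
      1 ∎
    countΔ : suc δ ≡ Δ → countDeg G Δ ≡ 2
    countΔ refl = begin
      countDeg G Δ
        ≡⟨ countDeg-OddExtremal G Δ odd ⟩
      bit (does (Δ ≟ Δ)) + (bit (does (Δ ≟ Δ)) + (Δ ∸ 1) * bit (does (δ ≟ Δ)))
        ≡⟨ cong₂ _+_ (bit≡1 {Δ} refl) (cong₂ (λ b c → b + (Δ ∸ 1) * c) (bit≡1 {Δ} refl) (bit≡0 (ℕₚ.<⇒≢ δ<Δ))) ⟩
      2 + (Δ ∸ 1) * 0
        ≡⟨ cong (2 +_) (ℕₚ.*-zeroʳ (Δ ∸ 1)) ⟩
      2 ∎

  Extremal⇒InClass : ∀ {δ Δ} G → 1 ≤ δ → δ ≤ Δ → Extremal δ Δ (deg G) → InClass δ Δ G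
  Extremal⇒InClass {δ} {Δ} G 1≤δ δ≤Δ extremal@(inj₁ (2∣ , even@(n≡ , u₀ , d₀ , others))) with δ ≟ Δ
  ... | yes refl = Extremal⇒HasMinMax G 1≤δ δ≤Δ extremal ,
                   inj₁ (refl , n≡ , deg≡n∸1⇒complete G λ u → trans (regular u) (cong (_∸ 1) (sym n≡)))
    where
    regular : ∀ u → deg G u ≡ Δ
    regular u with u Fin.≟ u₀
    ... | yes refl = d₀
    ... | no u≢u₀  = others u u≢u₀
  ... | no δ≢Δ = Extremal⇒HasMinMax G 1≤δ δ≤Δ extremal ,
                 inj₂ (inj₁ (ℕₚ.≤∧≢⇒< δ≤Δ δ≢Δ , 2∣ , n≡ , EvenExtremal⇒countDeg G δ≢Δ even))
  Extremal⇒InClass {δ} {Δ} G 1≤δ δ≤Δ extremal@(inj₂ (2∤ , odd@(n≡ , _))) with ℕₚ.m≤n⇒m<n∨m≡n δ<Δ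
    where δ<Δ = ℕₚ.≤∧≢⇒< δ≤Δ (2∤m*[1+n]⇒n≢m 2∤)
  ... | inj₁ 1+δ<Δ = Extremal⇒HasMinMax G 1≤δ δ≤Δ extremal ,
                     inj₂ (inj₂ (inj₁ (1+δ<Δ , 2∤ , n≡ , proj₁ counts , proj₁ (proj₂ counts) 1+δ<Δ)))
    where counts = OddExtremal⇒countDeg G (ℕₚ.<-trans (ℕₚ.n<1+n δ) 1+δ<Δ) odd
  ... | inj₂ 1+δ≡Δ = Extremal⇒HasMinMax G 1≤δ δ≤Δ extremal ,
                     inj₂ (inj₂ (inj₂ (1+δ≡Δ , 2∤m*[1+n]⇒2∤m Δ δ 2∤ , n≡ ,
                                       proj₁ counts , proj₂ (proj₂ counts) 1+δ≡Δ)))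
    where counts = OddExtremal⇒countDeg G (subst (δ <_) 1+δ≡Δ (ℕₚ.n<1+n δ)) odd

  -- Extremal graphs: cones over circulants

  countBelow : (ℕ → Bool) → ℕ → ℕ
  countBelow p zero    = 0
  countBelow p (suc n) = bit (p 0) + countBelow (p ∘ suc) n

  sum≡countBelow : ∀ {m} (p : ℕ → Bool) → sum (bit ∘ p ∘ toℕ {m}) ≡ countBelow p m
  sum≡countBelow {zero}  p = refl
  sum≡countBelow {suc m} p = cong (bit (p 0) +_) (sum≡countBelow {m} (p ∘ suc))

  countBelow-cong : ∀ n {p q : ℕ → Bool} → (∀ j → j < n → p j ≡ q j) → countBelow p n ≡ countBelow q n
  countBelow-cong zero    p≗q = refl
  countBelow-cong (suc n) p≗q =
    cong₂ _+_ (cong bit (p≗q 0 (s≤s z≤n))) (countBelow-cong n λ j j<n → p≗q (suc j) (s≤s j<n))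

  countBelow-++ : ∀ a b p → countBelow p (a + b) ≡ countBelow p a + countBelow (λ x → p (a + x)) b
  countBelow-++ zero    b p = refl
  countBelow-++ (suc a) b p =
    trans (cong (bit (p 0) +_) (countBelow-++ a b (p ∘ suc))) (sym (ℕₚ.+-assoc (bit (p 0)) _ _))

  countBelow-true : ∀ n → countBelow (λ _ → true) n ≡ n
  countBelow-true zero    = refl
  countBelow-true (suc n) = cong suc (countBelow-true n)

  countBelow-false : ∀ n → countBelow (λ _ → false) n ≡ 0
  countBelow-false zero    = refl
  countBelow-false (suc n) = countBelow-false n

  countBelow-point : ∀ n q → q < n → countBelow (λ x → does (x ≟ q)) n ≡ 1
  countBelow-point (suc n) zero    _         = cong suc (trans (countBelow-cong n λ _ _ → refl) (countBelow-false n))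
  countBelow-point (suc n) (suc q) (s≤s q<n) = trans (countBelow-cong n λ _ _ → refl) (countBelow-point n q q<n)

  countBelow-point-outside : ∀ n q → n ≤ q → countBelow (λ x → does (x ≟ q)) n ≡ 0
  countBelow-point-outside zero    q       _         = refl
  countBelow-point-outside (suc n) (suc q) (s≤s n≤q) =
    trans (countBelow-cong n λ _ _ → refl) (countBelow-point-outside n q n≤q)

  countBelow-∧-not : ∀ n (p q : ℕ → Bool) → (∀ j → q j ≡ true → p j ≡ true) →
                countBelow (λ j → p j ∧ not (q j)) n + countBelow q n ≡ countBelow p n
  countBelow-∧-not zero    p q q⊆p = refl
  countBelow-∧-not (suc n) p q q⊆p = begin
    bit (p 0 ∧ not (q 0)) + P + (bit (q 0) + Q)   ≡⟨ interchange (bit (p 0 ∧ not (q 0))) P (bit (q 0)) Q ⟩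
    bit (p 0 ∧ not (q 0)) + bit (q 0) + (P + Q)   ≡⟨ cong₂ _+_ (bits (p 0) (q 0) (q⊆p 0))
                                                             (countBelow-∧-not n (p ∘ suc) (q ∘ suc) (q⊆p ∘ suc)) ⟩
    bit (p 0) + countBelow (p ∘ suc) n            ∎
    where
    open ≡-Reasoning
    P = countBelow (λ j → p (suc j) ∧ not (q (suc j))) n
    Q = countBelow (q ∘ suc) n
    bits : ∀ a b → (b ≡ true → a ≡ true) → bit (a ∧ not b) + bit b ≡ bit a
    bits true  true  _   = refl
    bits true  false _   = refl
    bits false false _   = refl
    bits false true  b⇒a with () ← b⇒a refl

  double-cancel-≤ : ∀ {a b} → a + a ≤ b + b → a ≤ b
  double-cancel-≤ {a} {b} a+a≤b+b with a ℕ.≤? b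
  ... | yes a≤b = a≤b
  ... | no  a≰b = ⊥-elim (ℕₚ.<⇒≱ (ℕₚ.+-mono-< (ℕₚ.≰⇒> a≰b) (ℕₚ.≰⇒> a≰b)) a+a≤b+b)

  double-injective : ∀ {a b} → a + a ≡ b + b → a ≡ b
  double-injective eq = ℕₚ.≤-antisym (double-cancel-≤ (ℕₚ.≤-reflexive eq)) (double-cancel-≤ (ℕₚ.≤-reflexive (sym eq)))

  SymmetricConnection : ℕ → (ℕ → Bool) → Set
  SymmetricConnection m S = S 0 ≡ false × (∀ d → 1 ≤ d → d < m → S d ≡ S (m ∸ d))

  -- By symmetry of S, the distances i − j to the vertices j < i may be replaced by m − (i − j); together with
  -- the distances to the vertices above i these are 1, …, m − 1, each once.
  countBelow-distance : ∀ m (S : ℕ → Bool) → SymmetricConnection m S → ∀ i → i < m →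
                   countBelow (λ j → S ∣ i - j ∣) m ≡ countBelow S m
  countBelow-distance m S (S0 , S-sym) i i<m =
    subst (λ m → countBelow (λ j → S ∣ i - j ∣) m ≡ countBelow S m) i+[1+c]≡m countBelow-from-middle
    where
    open ≡-Reasoning
    c = m ∸ suc i
    i+[1+c]≡m : i + suc c ≡ m
    i+[1+c]≡m = trans (ℕₚ.+-suc i c) (ℕₚ.m+[n∸m]≡n i<m)

    below : ∀ j → j < i → S ∣ i - j ∣ ≡ S (suc (c + j))
    below j j<i = begin
      S ∣ i - j ∣                   ≡⟨ cong S (ℕₚ.m≤n⇒∣n-m∣≡n∸m (ℕₚ.<⇒≤ j<i)) ⟩
      S (i ∸ j)                     ≡⟨ S-sym (i ∸ j) (ℕₚ.m<n⇒0<n∸m j<i) (ℕₚ.≤-<-trans (ℕₚ.m∸n≤m i j) i<m) ⟩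
      S (m ∸ (i ∸ j))               ≡⟨ cong (λ m → S (m ∸ (i ∸ j))) (sym i+[1+c]≡m) ⟩
      S ((i + suc c) ∸ (i ∸ j))     ≡⟨ cong S reflect ⟩
      S (suc (c + j))               ∎
      where
      reflect : (i + suc c) ∸ (i ∸ j) ≡ suc (c + j)
      reflect = begin
        (i + suc c) ∸ (i ∸ j)                 ≡⟨ cong (λ x → (x + suc c) ∸ (i ∸ j)) (ℕₚ.m+[n∸m]≡n (ℕₚ.<⇒≤ j<i)) ⟨
        (j + (i ∸ j) + suc c) ∸ (i ∸ j)       ≡⟨ cong (_∸ (i ∸ j)) (ℕₚ.+-comm (j + (i ∸ j)) (suc c)) ⟩
        (suc c + (j + (i ∸ j))) ∸ (i ∸ j)     ≡⟨ cong (_∸ (i ∸ j)) (ℕₚ.+-assoc (suc c) j (i ∸ j)) ⟨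
        (suc c + j + (i ∸ j)) ∸ (i ∸ j)       ≡⟨ ℕₚ.m+n∸n≡m (suc c + j) (i ∸ j) ⟩
        suc (c + j)                           ∎

    countBelow-from-middle : countBelow (λ j → S ∣ i - j ∣) (i + suc c) ≡ countBelow S (i + suc c)
    countBelow-from-middle = begin
      countBelow (λ j → S ∣ i - j ∣) (i + suc c)
        ≡⟨ countBelow-++ i (suc c) (λ j → S ∣ i - j ∣) ⟩
      countBelow (λ j → S ∣ i - j ∣) i + (bit (S ∣ i - i + 0 ∣) + countBelow (λ x → S ∣ i - i + suc x ∣) c)
        ≡⟨ cong₂ (λ a b → a + (bit b + countBelow (λ x → S ∣ i - i + suc x ∣) c))
                 (countBelow-cong i below) (trans (cong S (ℕₚ.∣m-m+n∣≡n i 0)) S0) ⟩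
      countBelow (λ x → S (suc (c + x))) i + countBelow (λ x → S ∣ i - i + suc x ∣) c
        ≡⟨ cong (countBelow (λ x → S (suc (c + x))) i +_) (countBelow-cong c λ x _ → cong S (ℕₚ.∣m-m+n∣≡n i (suc x))) ⟩
      countBelow (λ x → S (suc (c + x))) i + countBelow (S ∘ suc) c
        ≡⟨ ℕₚ.+-comm (countBelow (λ x → S (suc (c + x))) i) _ ⟩
      countBelow (S ∘ suc) c + countBelow (λ x → S (suc (c + x))) i
        ≡⟨ countBelow-++ c i (S ∘ suc) ⟨
      countBelow (S ∘ suc) (c + i)
        ≡⟨ cong (λ b → bit b + countBelow (S ∘ suc) (c + i)) S0 ⟨
      countBelow S (suc (c + i))
        ≡⟨ cong (countBelow S) (trans (cong suc (ℕₚ.+-comm c i)) (sym (ℕₚ.+-suc i c))) ⟩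
      countBelow S (i + suc c) ∎

  -- Connection set of a circulant on m vertices: cyclic distance d ⊓ (m ∸ d) at most t, plus d = m/2 if antipodal.
  band : (m t : ℕ) → (antipodal : Bool) → ℕ → Bool
  band m t a d = does (1 ≤? d) ∧ (does (d ⊓ (m ∸ d) ≤? t) ∨ (a ∧ does (d + d ≟ m)))

  band-symmetric : ∀ m t a → SymmetricConnection m (band m t a)
  band-symmetric m t a = refl , mirror
    where
    half : ∀ x → x + x ≡ m → m ∸ x ≡ x
    half x x+x≡m = trans (cong (_∸ x) (sym x+x≡m)) (ℕₚ.m+n∸n≡m x x)

    mirror : ∀ d → 1 ≤ d → d < m → band m t a d ≡ band m t a (m ∸ d)
    mirror d 1≤d d<m =
      cong₂ _∧_ (trans (dec-true (1 ≤? d) 1≤d) (sym (dec-true (1 ≤? e) (ℕₚ.m<n⇒0<n∸m d<m))))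
        (cong₂ _∨_ (cong (λ x → does (x ≤? t)) (trans (ℕₚ.⊓-comm d e) (cong (e ⊓_) (sym m∸e≡d))))
                   (cong (a ∧_) (does-⇔ antipode (d + d ≟ m) (e + e ≟ m))))
      where
      e = m ∸ d
      m∸e≡d : m ∸ e ≡ d
      m∸e≡d = ℕₚ.m∸[m∸n]≡n (ℕₚ.<⇒≤ d<m)
      antipode : d + d ≡ m ⇔ e + e ≡ m
      antipode = mk⇔ (λ d+d≡m → subst (λ x → x + x ≡ m) (sym (half d d+d≡m)) d+d≡m)
                     (λ e+e≡m → subst (λ x → x + x ≡ m) (trans (sym (half e e+e≡m)) m∸e≡d) e+e≡m)

  countBelow-band : ∀ t c a → let m = suc (t + (c + t)) in
               countBelow (band m t a) m ≡ t + (countBelow (λ x → a ∧ does (suc (t + x) + suc (t + x) ≟ m)) c + t)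
  countBelow-band t c a = begin
    countBelow (band m t a ∘ suc) (t + (c + t))
      ≡⟨ countBelow-++ t (c + t) (band m t a ∘ suc) ⟩
    countBelow (band m t a ∘ suc) t + countBelow (λ x → band m t a (suc (t + x))) (c + t)
      ≡⟨ cong (countBelow (band m t a ∘ suc) t +_) (countBelow-++ c t (λ x → band m t a (suc (t + x)))) ⟩
    countBelow (band m t a ∘ suc) t
      + (countBelow (λ x → band m t a (suc (t + x))) c + countBelow (λ x → band m t a (suc (t + (c + x)))) t)
      ≡⟨ cong₂ (λ p q → p + (countBelow (λ x → band m t a (suc (t + x))) c + q))
               (trans (countBelow-cong t near) (countBelow-true t))
               (trans (countBelow-cong t far) (countBelow-true t)) ⟩
    t + (countBelow (λ x → band m t a (suc (t + x))) c + t)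
      ≡⟨ cong (λ b → t + (b + t)) (countBelow-cong c middle) ⟩
    t + (countBelow (λ x → a ∧ does (suc (t + x) + suc (t + x) ≟ m)) c + t) ∎
    where
    open ≡-Reasoning
    m = suc (t + (c + t))
    inside : ∀ d → 1 ≤ d → d ⊓ (m ∸ d) ≤ t → band m t a d ≡ true
    inside d 1≤d close =
      cong₂ (λ p q → p ∧ (q ∨ (a ∧ does (d + d ≟ m)))) (dec-true (1 ≤? d) 1≤d) (dec-true (d ⊓ (m ∸ d) ≤? t) close)
    near : ∀ x → x < t → band m t a (suc x) ≡ true
    near x x<t = inside (suc x) (s≤s z≤n) (ℕₚ.≤-trans (ℕₚ.m⊓n≤m (suc x) _) x<t)
    far : ∀ x → x < t → band m t a (suc (t + (c + x))) ≡ true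
    far x _ = inside (suc (t + (c + x))) (s≤s z≤n) (ℕₚ.≤-trans (ℕₚ.m⊓n≤n _ (m ∸ suc (t + (c + x)))) far-gap)
      where
      far-gap : m ∸ suc (t + (c + x)) ≤ t
      far-gap = subst (_≤ t) (sym (trans (ℕₚ.[m+n]∸[m+o]≡n∸o t (c + t) (c + x)) (ℕₚ.[m+n]∸[m+o]≡n∸o c t x)))
                      (ℕₚ.m∸n≤m t x)
    middle : ∀ x → x < c → band m t a (suc (t + x)) ≡ a ∧ does (suc (t + x) + suc (t + x) ≟ m)
    middle x x<c = cong₂ (λ p q → p ∧ (q ∨ (a ∧ does (suc (t + x) + suc (t + x) ≟ m))))
                         (dec-true (1 ≤? suc (t + x)) (s≤s z≤n))
                         (dec-false (suc (t + x) ⊓ (m ∸ suc (t + x)) ≤? t) (ℕₚ.<⇒≱ (ℕₚ.⊓-glb t<d t<m∸d)))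
      where
      t<d : t < suc (t + x)
      t<d = s≤s (ℕₚ.m≤m+n t x)
      t<m∸d : t < m ∸ suc (t + x)
      t<m∸d = subst (t <_) (sym (trans (ℕₚ.[m+n]∸[m+o]≡n∸o t (c + t) x) (ℕₚ.+-∸-comm t (ℕₚ.<⇒≤ x<c))))
                    (ℕₚ.m<n+m t (ℕₚ.m<n⇒0<n∸m x<c))

  countBelow-band-ball : ∀ {m} t c → suc (t + (c + t)) ≡ m → countBelow (band m t false) m ≡ t + t
  countBelow-band-ball t c refl = trans (countBelow-band t c false) (cong (λ x → t + (x + t)) (countBelow-false c))

  antipodal-size : ∀ t r → ℕ.suc (t + (ℕ.suc (r + r) + t)) ≡ (ℕ.suc t + r) + (ℕ.suc t + r)
  antipodal-size = solve-∀

  countBelow-band-antipodal : ∀ {m} t r → suc (t + (suc (r + r) + t)) ≡ m → countBelow (band m t true) m ≡ suc (t + t)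
  countBelow-band-antipodal t r refl =
    trans (countBelow-band t (suc (r + r)) true) (trans (cong (λ x → t + (x + t)) centre) (ℕₚ.+-suc t t))
    where
    m = suc (t + (suc (r + r) + t))
    antipode : ∀ x → suc (t + x) + suc (t + x) ≡ m ⇔ x ≡ r
    antipode x = mk⇔ (λ eq → ℕₚ.+-cancelˡ-≡ (suc t) x r (double-injective (trans eq (antipodal-size t r))))
                     (λ { refl → sym (antipodal-size t r) })
    centre : countBelow (λ x → does (suc (t + x) + suc (t + x) ≟ m)) (suc (r + r)) ≡ 1
    centre = trans (countBelow-cong (suc (r + r)) λ x _ → does-⇔ (antipode x) (suc (t + x) + suc (t + x) ≟ m) (x ≟ r))
                   (countBelow-point (suc (r + r)) r (s≤s (ℕₚ.m≤m+n r r)))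

  circulant : (ℕ → Bool) → ℕ → ℕ → Bool
  circulant S i j = S ∣ i - j ∣

  circulant-sym : ∀ S i j → circulant S i j ≡ circulant S j i
  circulant-sym S i j = cong S (ℕₚ.∣-∣-comm i j)

  circulant-irrefl : ∀ S → S 0 ≡ false → ∀ i → circulant S i i ≡ false
  circulant-irrefl S S0 i = trans (cong S (ℕₚ.∣n-n∣≡0 i)) S0

  partner : ℕ → ℕ
  partner 0             = 1
  partner 1             = 0
  partner (suc (suc i)) = suc (suc (partner i))

  partner-involutive : ∀ i → partner (partner i) ≡ i
  partner-involutive 0             = refl
  partner-involutive 1             = refl
  partner-involutive (suc (suc i)) = cong (λ x → suc (suc x)) (partner-involutive i)

  ∣i-partner[i]∣≡1 : ∀ i → ∣ i - partner i ∣ ≡ 1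
  ∣i-partner[i]∣≡1 0             = refl
  ∣i-partner[i]∣≡1 1             = refl
  ∣i-partner[i]∣≡1 (suc (suc i)) = ∣i-partner[i]∣≡1 i

  partner≤1+i : ∀ i → partner i ≤ suc i
  partner≤1+i 0             = s≤s z≤n
  partner≤1+i 1             = z≤n
  partner≤1+i (suc (suc i)) = s≤s (s≤s (partner≤1+i i))

  partner[q+q]≡1+q+q : ∀ q → partner (q + q) ≡ suc (q + q)
  partner[q+q]≡1+q+q zero    = refl
  partner[q+q]≡1+q+q (suc q) = begin
    partner (suc (q + suc q))   ≡⟨ cong (λ x → partner (suc x)) (ℕₚ.+-suc q q) ⟩
    suc (suc (partner (q + q))) ≡⟨ cong (λ x → suc (suc x)) (partner[q+q]≡1+q+q q) ⟩
    suc (suc (suc (q + q)))     ≡⟨ cong (λ x → suc (suc x)) (ℕₚ.+-suc q q) ⟨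
    suc (suc (q + suc q))       ∎
    where open ≡-Reasoning

  matching : ℕ → ℕ → Bool
  matching i j = does (j ≟ partner i)

  matching-sym : ∀ i j → matching i j ≡ matching j i
  matching-sym i j = does-⇔ (mk⇔ (λ { refl → sym (partner-involutive i) }) (λ { refl → sym (partner-involutive j) }))
                             (j ≟ partner i) (i ≟ partner j)

  matching⊆band : ∀ m t → 1 ≤ t → ∀ i j → matching i j ≡ true → circulant (band m t false) i j ≡ true
  matching⊆band m t 1≤t i j ij with refl ← does≡true⇒ (j ≟ partner i) ij rewrite ∣i-partner[i]∣≡1 i =
    cong (λ b → b ∨ false) (dec-true (1 ⊓ (m ∸ 1) ≤? t) (ℕₚ.≤-trans (ℕₚ.m⊓n≤m 1 (m ∸ 1)) 1≤t))

  countBelow-matching : ∀ m i → partner i < m → countBelow (matching i) m ≡ 1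
  countBelow-matching m i p<m = countBelow-point m (partner i) p<m

  countBelow-matching-outside : ∀ m i → m ≤ partner i → countBelow (matching i) m ≡ 0
  countBelow-matching-outside m i m≤p = countBelow-point-outside m (partner i) m≤p

  coneAdj : (ℕ → ℕ → Bool) → ∀ {m} → Fin (suc m) → Fin (suc m) → Bool
  coneAdj H zero    zero    = false
  coneAdj H zero    (suc v) = true
  coneAdj H (suc u) zero    = true
  coneAdj H (suc u) (suc v) = H (toℕ u) (toℕ v)

  module Cone (m : ℕ) (H : ℕ → ℕ → Bool) (H-sym : ∀ i j → H i j ≡ H j i) (H-irrefl : ∀ i → H i i ≡ false) where
    coneAdj-sym : ∀ (u v : Fin (suc m)) → coneAdj H u v ≡ coneAdj H v u
    coneAdj-sym zero    zero    = refl
    coneAdj-sym zero    (suc v) = refl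
    coneAdj-sym (suc u) zero    = refl
    coneAdj-sym (suc u) (suc v) = H-sym (toℕ u) (toℕ v)

    coneAdj-irrefl : ∀ (u : Fin (suc m)) → coneAdj H u u ≡ false
    coneAdj-irrefl zero    = refl
    coneAdj-irrefl (suc u) = H-irrefl (toℕ u)

    Γ : Graph
    Γ = record { n = suc m ; adj = coneAdj H ; sym = coneAdj-sym ; irrefl = coneAdj-irrefl }

    deg-apex : deg Γ zero ≡ m
    deg-apex = trans (deg≡sum Γ zero) (all⇒sum-bits≡size (λ (v : Fin m) → true) λ _ → refl)

    deg-rim : ∀ u → deg Γ (suc u) ≡ suc (countBelow (H (toℕ u)) m)
    deg-rim u = trans (deg≡sum Γ (suc u)) (cong suc (sum≡countBelow {m} (H (toℕ u))))

    EvenExtremal-cone : ∀ r → (∀ u → countBelow (H (toℕ u)) m ≡ r) → EvenExtremal (suc r) m (deg Γ)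
    EvenExtremal-cone r regular = refl , zero , deg-apex , λ where
      zero    0≢0 → ⊥-elim (0≢0 refl)
      (suc u) _   → trans (deg-rim u) (cong suc (regular u))

    OddExtremal-cone : ∀ r (s : Fin m) → countBelow (H (toℕ s)) m ≡ suc r →
                       (∀ u → u ≢ s → countBelow (H (toℕ u)) m ≡ r) → OddExtremal (suc r) m (deg Γ)
    OddExtremal-cone r s special regular =
      refl , zero , suc s , (λ ()) , deg-apex , trans (deg-rim s) (cong suc special) , λ where
        zero    0≢0 _     → ⊥-elim (0≢0 refl)
        (suc u) _   u≢s → trans (deg-rim u) (cong suc (regular u (u≢s ∘ cong suc)))

  ball-graph : ∀ t {Δ} → suc (t + t) ≤ Δ → Σ[ Γ ∈ Graph ] EvenExtremal (suc (t + t)) Δ (deg Γ)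
  ball-graph t {Δ} δ≤Δ = Γ , EvenExtremal-cone (t + t) regular
    where
    S = band Δ t false
    open Cone Δ (circulant S) (circulant-sym S) (circulant-irrefl S refl)
    c = Δ ∸ suc (t + t)
    size : suc (t + (c + t)) ≡ Δ
    size = trans (cong suc (reorder t c)) (ℕₚ.m+[n∸m]≡n δ≤Δ)
      where
      reorder : ∀ t c → t + (c + t) ≡ (t + t) + c
      reorder = solve-∀
    regular : ∀ u → countBelow (circulant S (toℕ u)) Δ ≡ t + t
    regular u = trans (countBelow-distance Δ S (band-symmetric Δ t false) (toℕ u) (toℕ<n u))
                      (countBelow-band-ball t c size)

  antipodal-graph : ∀ t p → suc (suc (t + t)) ≤ p + p →
                    Σ[ Γ ∈ Graph ] EvenExtremal (suc (suc (t + t))) (p + p) (deg Γ)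
  antipodal-graph t p δ≤Δ = Γ , EvenExtremal-cone (suc (t + t)) regular
    where
    S = band (p + p) t true
    open Cone (p + p) (circulant S) (circulant-sym S) (circulant-irrefl S refl)
    1+t≤p : suc t ≤ p
    1+t≤p = double-cancel-≤ (subst (_≤ p + p) (cong suc (sym (ℕₚ.+-suc t t))) δ≤Δ)
    r = p ∸ suc t
    size : suc (t + (suc (r + r) + t)) ≡ p + p
    size = trans (antipodal-size t r) (cong (λ x → x + x) (ℕₚ.m+[n∸m]≡n 1+t≤p))
    regular : ∀ u → countBelow (circulant S (toℕ u)) (p + p) ≡ suc (t + t)
    regular u = trans (countBelow-distance (p + p) S (band-symmetric (p + p) t true) (toℕ u) (toℕ<n u))
                      (countBelow-band-antipodal t r size)

  -- The circulant with band t + 1 is (2t + 2)-regular; removing the matching {0, 1}, {2, 3}, … lowers every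
  -- degree by one except that of the last vertex.
  matched-graph : ∀ t q → suc (suc (t + t)) < suc (q + q) →
                  Σ[ Γ ∈ Graph ] OddExtremal (suc (suc (t + t))) (suc (q + q)) (deg Γ)
  matched-graph t q δ<Δ = Γ , OddExtremal-cone (suc (t + t)) s special regular
    where
    open ≡-Reasoning
    Δ = suc (q + q)
    S = band Δ (suc t) false
    H : ℕ → ℕ → Bool
    H i j = circulant S i j ∧ not (matching i j)
    H-sym : ∀ i j → H i j ≡ H j i
    H-sym i j = cong₂ (λ a b → a ∧ not b) (circulant-sym S i j) (matching-sym i j)
    H-irrefl : ∀ i → H i i ≡ false
    H-irrefl i = cong (λ a → a ∧ not (matching i i)) (circulant-irrefl S refl i)
    open Cone Δ H H-sym H-irrefl
    1+t≤q : suc t ≤ q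
    1+t≤q = double-cancel-≤ (subst (_≤ q + q) (cong suc (sym (ℕₚ.+-suc t t))) (ℕₚ.≤-pred δ<Δ))
    e = q ∸ suc t
    size : suc (suc t + ((e + e) + suc t)) ≡ Δ
    size = cong suc (trans (reorder (suc t) e) (cong (λ x → x + x) (ℕₚ.m+[n∸m]≡n 1+t≤q)))
      where
      reorder : ∀ a e → a + ((e + e) + a) ≡ (a + e) + (a + e)
      reorder = solve-∀
    unmatched+matched : ∀ i → i < Δ → countBelow (H i) Δ + countBelow (matching i) Δ ≡ suc (suc (t + t))
    unmatched+matched i i<Δ = begin
      countBelow (H i) Δ + countBelow (matching i) Δ
        ≡⟨ countBelow-∧-not Δ (circulant S i) (matching i) (matching⊆band Δ (suc t) (s≤s z≤n) i) ⟩
      countBelow (circulant S i) Δ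
        ≡⟨ countBelow-distance Δ S (band-symmetric Δ (suc t) false) i i<Δ ⟩
      countBelow S Δ
        ≡⟨ countBelow-band-ball (suc t) (e + e) size ⟩
      suc t + suc t
        ≡⟨ cong suc (ℕₚ.+-suc t t) ⟩
      suc (suc (t + t)) ∎
    s : Fin Δ
    s = Fin.fromℕ (q + q)
    special : countBelow (H (toℕ s)) Δ ≡ suc (suc (t + t))
    special = begin
      countBelow (H (toℕ s)) Δ
        ≡⟨ ℕₚ.+-identityʳ _ ⟨
      countBelow (H (toℕ s)) Δ + 0
        ≡⟨ cong (countBelow (H (toℕ s)) Δ +_) (countBelow-matching-outside Δ (toℕ s) Δ≤partner) ⟨
      countBelow (H (toℕ s)) Δ + countBelow (matching (toℕ s)) Δ
        ≡⟨ unmatched+matched (toℕ s) (toℕ<n s) ⟩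
      suc (suc (t + t)) ∎
      where
      Δ≤partner : Δ ≤ partner (toℕ s)
      Δ≤partner = ℕₚ.≤-reflexive (sym (trans (cong partner (toℕ-fromℕ (q + q))) (partner[q+q]≡1+q+q q)))
    regular : ∀ u → u ≢ s → countBelow (H (toℕ u)) Δ ≡ suc (t + t)
    regular u u≢s = ℕₚ.suc-injective (trans (ℕₚ.+-comm 1 _) (trans
                      (cong (countBelow (H (toℕ u)) Δ +_) (sym (countBelow-matching Δ (toℕ u) partner<Δ)))
                      (unmatched+matched (toℕ u) (toℕ<n u))))
      where
      u<q+q : toℕ u < q + q
      u<q+q = ℕₚ.≤∧≢⇒< (ℕₚ.≤-pred (toℕ<n u)) λ eq → u≢s (toℕ-injective (trans eq (sym (toℕ-fromℕ (q + q)))))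
      partner<Δ : partner (toℕ u) < Δ
      partner<Δ = s≤s (ℕₚ.≤-trans (partner≤1+i (toℕ u)) u<q+q)

  extremal-graph : ∀ {δ Δ} → 1 ≤ δ → δ ≤ Δ → Σ[ Γ ∈ Graph ] Extremal δ Δ (deg Γ)
  extremal-graph {suc δ′} {Δ} _ δ≤Δ with 2 ∣? Δ * suc (suc δ′) | halve δ′
  ... | yes 2∣ | t , inj₁ refl = map₂ (λ even → inj₁ (2∣ , even)) (ball-graph t δ≤Δ)
  ... | yes 2∣ | t , inj₂ refl with halve Δ
  ...   | p , inj₁ refl = map₂ (λ even → inj₁ (2∣ , even)) (antipodal-graph t p δ≤Δ)
  ...   | p , inj₂ refl = ⊥-elim (2∤m⇒2∤n⇒2∤m*n Δ _ (2∣n⇒2∤1+n (2∣n+n p)) (2∣n⇒2∤1+n (2∣2+n+n t)) 2∣)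
  extremal-graph {suc δ′} {Δ} _ δ≤Δ | no 2∤ | t , inj₁ refl = ⊥-elim (2∤ (∣n⇒∣m*n Δ (2∣2+n+n t)))
  extremal-graph {suc δ′} {Δ} _ δ≤Δ | no 2∤ | t , inj₂ refl with halve Δ
  ...   | p , inj₁ refl = ⊥-elim (2∤ (∣m⇒∣m*n _ (2∣n+n p)))
  ...   | p , inj₂ refl = map₂ (λ odd → inj₂ (2∤ , odd)) (matched-graph t p (ℕₚ.≤∧≢⇒< δ≤Δ (2∤m*[1+n]⇒n≢m 2∤)))

module OrderedAbelianGroupProperties (R : OrderedAbelianGroup) where
  open OrderedAbelianGroup R renaming (+-mono-≤ to +-monoˡ-≤)
  open IsAbelianGroup isAbelianGroup using (assoc; comm; identityʳ; inverseʳ; isCommutativeMonoid)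
  open IsTotalOrder isTotalOrder using (antisym) renaming (refl to ≤-refl; trans to ≤-trans; reflexive to ≤-reflexive)

  commutativeMonoid : CommutativeMonoid 0ℓ 0ℓ
  commutativeMonoid = record { isCommutativeMonoid = isCommutativeMonoid }

  open import Algebra.Definitions.RawMonoid (CommutativeMonoid.rawMonoid commutativeMonoid)
    using () renaming (_×_ to _×ᴹ_)

  poset : Poset 0ℓ 0ℓ 0ℓ
  poset = record { isPartialOrder = IsTotalOrder.isPartialOrder isTotalOrder }

  open MonoidSum commutativeMonoid using (sum) public

  ×ᴹ≡· : ∀ m x → m ×ᴹ x ≡ m · x
  ×ᴹ≡· zero    x = refl
  ×ᴹ≡· (suc m) x = cong (x +_) (×ᴹ≡· m x)

  +-monoʳ-≤ : ∀ z {x y} → x ≤ y → z + x ≤ z + y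
  +-monoʳ-≤ z {x} {y} x≤y = subst₂ _≤_ (comm x z) (comm y z) (+-monoˡ-≤ z x≤y)

  +-mono-≤ : ∀ {a b c d} → a ≤ b → c ≤ d → a + c ≤ b + d
  +-mono-≤ {b = b} {c} a≤b c≤d = ≤-trans (+-monoˡ-≤ c a≤b) (+-monoʳ-≤ b c≤d)

  +-cancelʳ-≤ : ∀ z {x y} → x + z ≤ y + z → x ≤ y
  +-cancelʳ-≤ z {x} {y} le = subst₂ _≤_ (cancel x) (cancel y) (+-monoˡ-≤ (- z) le)
    where
    cancel : ∀ w → w + z + - z ≡ w
    cancel w = trans (assoc w z (- z)) (trans (cong (w +_) (inverseʳ z)) (identityʳ w))

  +-cancelˡ-≤ : ∀ z {x y} → z + x ≤ z + y → x ≤ y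
  +-cancelˡ-≤ z {x} {y} le = +-cancelʳ-≤ z (subst₂ _≤_ (comm z x) (comm z y) le)

  +-mono-≤-tight : ∀ {a a′ b b′} → a ≤ a′ → b ≤ b′ → a′ + b′ ≤ a + b → a ≡ a′ × b ≡ b′
  +-mono-≤-tight {a} {a′} {b} {b′} a≤a′ b≤b′ le =
    antisym a≤a′ (+-cancelʳ-≤ b (≤-trans (+-monoʳ-≤ a′ b≤b′) le)) ,
    antisym b≤b′ (+-cancelˡ-≤ a (≤-trans (+-monoˡ-≤ b′ a≤a′) le))

  x≤x+y : ∀ x {y} → 0# ≤ y → x ≤ x + y
  x≤x+y x 0≤y = subst (_≤ x + _) (identityʳ x) (+-monoʳ-≤ x 0≤y)

  0≤· : ∀ m {c} → 0# ≤ c → 0# ≤ m · c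
  0≤· zero    0≤c = ≤-refl
  0≤· (suc m) {c} 0≤c = ≤-trans 0≤c (x≤x+y c (0≤· m 0≤c))

  ·-monoˡ-≤ : ∀ {c} → 0# ≤ c → ∀ {k m} → k ℕ.≤ m → k · c ≤ m · c
  ·-monoˡ-≤ 0≤c {m = m} z≤n   = 0≤· m 0≤c
  ·-monoˡ-≤ {c} 0≤c (s≤s k≤m) = +-monoʳ-≤ c (·-monoˡ-≤ 0≤c k≤m)

  ·-cancelʳ-≡ : ∀ {c} → 0# < c → ∀ m k → m · c ≡ k · c → m ≡ k
  ·-cancelʳ-≡ 0<c zero    zero    _  = refl
  ·-cancelʳ-≡ 0<c zero    (suc k) eq = ⊥-elim (positive-sum 0<c k (sym eq))
    where
    positive-sum : ∀ {c} → 0# < c → ∀ k → c + k · c ≢ 0#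
    positive-sum {c} (0≤c , 0≢c) k eq = 0≢c (antisym 0≤c (subst (c ≤_) eq (x≤x+y c (0≤· k 0≤c))))
  ·-cancelʳ-≡ 0<c (suc m) zero    eq = sym (·-cancelʳ-≡ 0<c zero (suc m) (sym eq))
  ·-cancelʳ-≡ {c} 0<c (suc m) (suc k) eq =
    cong suc (·-cancelʳ-≡ 0<c m k (antisym (+-cancelˡ-≤ c (≤-reflexive eq)) (+-cancelˡ-≤ c (≤-reflexive (sym eq)))))

  sum-replicate : ∀ m c → sum (replicate m c) ≡ m · c
  sum-replicate zero    c = refl
  sum-replicate (suc m) c = cong (c +_) (sum-replicate m c)

  sum-mono-≤ : ∀ {m} {f g : Vector Carrier m} → (∀ i → f i ≤ g i) → sum f ≤ sum g
  sum-mono-≤ {zero}  f≤g = ≤-refl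
  sum-mono-≤ {suc m} f≤g = +-mono-≤ (f≤g zero) (sum-mono-≤ (f≤g ∘ suc))

  sum-mono-≤-tight : ∀ {m} {f g : Vector Carrier m} → (∀ i → f i ≤ g i) → sum g ≤ sum f → ∀ i → f i ≡ g i
  sum-mono-≤-tight {suc m} f≤g le zero    = proj₁ (+-mono-≤-tight (f≤g zero) (sum-mono-≤ (f≤g ∘ suc)) le)
  sum-mono-≤-tight {suc m} f≤g le (suc i) =
    sum-mono-≤-tight (f≤g ∘ suc) (≤-reflexive (sym (proj₂ (+-mono-≤-tight (f≤g zero) (sum-mono-≤ (f≤g ∘ suc)) le)))) i

  ·≤sum : ∀ {m c} {g : Vector Carrier m} → 0# ≤ c → (∀ i → c ≤ g i) → ∀ {k} → k ℕ.≤ m → k · c ≤ sum g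
  ·≤sum {m} {c} 0≤c c≤g k≤m =
    ≤-trans (·-monoˡ-≤ 0≤c k≤m) (subst (_≤ _) (sum-replicate m c) (sum-mono-≤ c≤g))

  ·≤sum-tight : ∀ {m c} {g : Vector Carrier m} → 0# < c → (∀ i → c ≤ g i) → ∀ {k} → k ℕ.≤ m → sum g ≤ k · c →
           m ≡ k × (∀ i → g i ≡ c)
  ·≤sum-tight {m} {c} {g} 0<c@(0≤c , _) c≤g {k} k≤m sum≤ = m≡k , λ i → sym (sum-mono-≤-tight c≤g sum≤replicate i)
    where
    replicate≤sum : m · c ≤ sum g
    replicate≤sum = subst (_≤ sum g) (sum-replicate m c) (sum-mono-≤ c≤g)
    m≡k : m ≡ k
    m≡k = ·-cancelʳ-≡ 0<c m k (antisym (≤-trans replicate≤sum sum≤) (·-monoˡ-≤ 0≤c k≤m))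
    sum≤replicate : sum g ≤ sum (replicate m c)
    sum≤replicate = subst (sum g ≤_) (trans (cong (_· c) (sym m≡k)) (sym (sum-replicate m c))) sum≤

module _ (R : OrderedAbelianGroup) where
  open OrderedAbelianGroup R using (Carrier; _≤_; _<_; 0#)

  module WeightBounds
    (h : ℕ → Carrier) (h-pos : ∀ k → 1 ℕ.≤ k → 0# < h k) (h-mono : ∀ j k → 1 ℕ.≤ j → j ℕ.≤ k → h j ≤ h k)
    {δ Δ : ℕ} (1≤δ : 1 ℕ.≤ δ) (δ≤Δ : δ ℕ.≤ Δ)
    where

    open OrderedAbelianGroup R using (_+_; _·_; ∑; isTotalOrder; isAbelianGroup)
    open OrderedAbelianGroupProperties R
    open IsTotalOrder isTotalOrder using (antisym) renaming (reflexive to ≤-reflexive)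
    open IsAbelianGroup isAbelianGroup using (comm)
    open MonoidSum commutativeMonoid using (sum-remove)
    open ExtremalSums commutativeMonoid using (sum-remove₂; sum-EvenExtremal; sum-OddExtremal)
    open import Relation.Binary.Reasoning.PartialOrder poset

    Γ* : Graph
    Γ* = proj₁ (extremal-graph 1≤δ δ≤Δ)

    Γ*-extremal : Extremal δ Δ (deg Γ*)
    Γ*-extremal = proj₂ (extremal-graph 1≤δ δ≤Δ)

    evenBound oddBound : Carrier
    evenBound = Δ · h δ + h Δ
    oddBound  = (Δ ∸ 1) · h δ + h (suc δ) + h Δ

    weight : ∀ {N} → (Fin N → ℕ) → Carrier
    weight d = sum (h ∘ d)

    ∑-tabulate : ∀ {m} (f : Vector Carrier m) → ∑ (tabulate f) ≡ sum f
    ∑-tabulate {zero}  f = refl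
    ∑-tabulate {suc m} f = cong (f zero +_) (∑-tabulate (f ∘ suc))

    𝒥≡weight : ∀ G → 𝒥 R h G ≡ weight (deg G)
    𝒥≡weight G = trans (cong ∑ (map-tabulate id (h ∘ deg G))) (∑-tabulate (h ∘ deg G))

    0≤hδ : 0# ≤ h δ
    0≤hδ = proj₁ (h-pos δ 1≤δ)

    hδ≤h : ∀ {k} → δ ℕ.≤ k → h δ ≤ h k
    hδ≤h = h-mono δ _ 1≤δ

    h-tight : ∀ {j k} → h j < h (suc j) → j ℕ.≤ k → h k ≡ h j → k ≡ j
    h-tight {j} (hj≤ , hj≢) j≤k hk≡hj with ℕₚ.m≤n⇒m<n∨m≡n j≤k
    ... | inj₁ j<k = ⊥-elim (hj≢ (antisym hj≤ (subst (h (suc j) ≤_) hk≡hj (h-mono _ _ (s≤s z≤n) j<k))))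
    ... | inj₂ j≡k = sym j≡k

    evenBound-hub : evenBound ≡ h Δ + Δ · h δ
    evenBound-hub = comm (Δ · h δ) (h Δ)

    oddBound-hub : oddBound ≡ h Δ + (h (suc δ) + (Δ ∸ 1) · h δ)
    oddBound-hub = trans (comm _ (h Δ)) (cong (h Δ +_) (comm ((Δ ∸ 1) · h δ) (h (suc δ))))

    weight-hub : ∀ {m} (d : Fin (suc m) → ℕ) {u₀} → d u₀ ≡ Δ → weight d ≡ h Δ + sum (h ∘ d ∘ punchIn u₀)
    weight-hub d {u₀} d₀ = trans (sum-remove {i = u₀} (h ∘ d)) (cong (λ x → h x + sum (h ∘ d ∘ punchIn u₀)) d₀)

    weight-hub₂ : ∀ {m} (d : Fin (suc (suc m)) → ℕ) {u₀ u₁} (u₁≢u₀ : u₁ ≢ u₀) → d u₀ ≡ Δ →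
                  weight d ≡ h Δ + (h (d u₁) + sum (h ∘ d ∘ punchIn₂ u₁≢u₀))
    weight-hub₂ d {u₀} {u₁} u₁≢u₀ d₀ =
      trans (sum-remove₂ (h ∘ d) u₁≢u₀) (cong (λ x → h x + (h (d u₁) + sum (h ∘ d ∘ punchIn₂ u₁≢u₀))) d₀)

    evenBound≤weight : ∀ {N} (d : Fin N → ℕ) {u₀} → (∀ v → δ ℕ.≤ d v) → d u₀ ≡ Δ → Δ ℕ.< N →
                       evenBound ≤ weight d
    evenBound≤weight {suc m} d {u₀} δ≤d d₀ Δ<N = begin
      evenBound                        ≡⟨ evenBound-hub ⟩
      h Δ + Δ · h δ                    ≤⟨ +-monoʳ-≤ (h Δ) (·≤sum 0≤hδ (hδ≤h ∘ δ≤d ∘ punchIn u₀) (ℕₚ.≤-pred Δ<N)) ⟩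
      h Δ + sum (h ∘ d ∘ punchIn u₀)   ≡⟨ weight-hub d d₀ ⟨
      weight d                         ∎

    oddBound≤weight : ∀ {N} (d : Fin N → ℕ) {u₀ u₁} → (∀ v → δ ℕ.≤ d v) → d u₀ ≡ Δ → Δ ℕ.< N →
                      u₁ ≢ u₀ → suc δ ℕ.≤ d u₁ → oddBound ≤ weight d
    oddBound≤weight {suc zero} d {zero} {zero} _ _ _ u₁≢u₀ = ⊥-elim (u₁≢u₀ refl)
    oddBound≤weight {suc (suc m)} d {u₀} {u₁} δ≤d d₀ Δ<N u₁≢u₀ 1+δ≤d₁ = begin
      oddBound                                         ≡⟨ oddBound-hub ⟩
      h Δ + (h (suc δ) + (Δ ∸ 1) · h δ)                ≤⟨ +-monoʳ-≤ (h Δ) (+-mono-≤ (h-mono _ _ (s≤s z≤n) 1+δ≤d₁)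
                                                            (·≤sum 0≤hδ (hδ≤h ∘ δ≤d ∘ punchIn₂ u₁≢u₀) Δ∸1≤m)) ⟩
      h Δ + (h (d u₁) + sum (h ∘ d ∘ punchIn₂ u₁≢u₀))  ≡⟨ weight-hub₂ d u₁≢u₀ d₀ ⟨
      weight d                                         ∎
      where Δ∸1≤m = ℕₚ.∸-monoˡ-≤ 1 (ℕₚ.≤-pred Δ<N)

    weight≤evenBound⇒EvenExtremal : h δ < h (suc δ) → ∀ {N} (d : Fin N → ℕ) {u₀} → (∀ v → δ ℕ.≤ d v) →
                                    d u₀ ≡ Δ → Δ ℕ.< N → weight d ≤ evenBound → EvenExtremal δ Δ d
    weight≤evenBound⇒EvenExtremal hδ<h1+δ {suc m} d {u₀} δ≤d d₀ Δ<N weight≤ = cong suc m≡Δ , u₀ , d₀ , others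
      where
      rest≤ : sum (h ∘ d ∘ punchIn u₀) ≤ Δ · h δ
      rest≤ = +-cancelˡ-≤ (h Δ) (subst₂ _≤_ (weight-hub d d₀) evenBound-hub weight≤)
      tight = ·≤sum-tight (h-pos δ 1≤δ) (hδ≤h ∘ δ≤d ∘ punchIn u₀) (ℕₚ.≤-pred Δ<N) rest≤
      m≡Δ = proj₁ tight
      others : ∀ v → v ≢ u₀ → d v ≡ δ
      others v v≢u₀ with j , refl ← punchIn-onto u₀ v≢u₀ = h-tight hδ<h1+δ (δ≤d _) (proj₂ tight j)

    weight≤oddBound⇒OddExtremal : h δ < h (suc δ) → h (suc δ) < h (suc (suc δ)) →
                                  ∀ {N} (d : Fin N → ℕ) {u₀ u₁} → (∀ v → δ ℕ.≤ d v) → d u₀ ≡ Δ → Δ ℕ.< N →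
                                  u₁ ≢ u₀ → suc δ ℕ.≤ d u₁ → weight d ≤ oddBound → OddExtremal δ Δ d
    weight≤oddBound⇒OddExtremal _ _ {suc zero} d {zero} {zero} _ _ _ u₁≢u₀ = ⊥-elim (u₁≢u₀ refl)
    weight≤oddBound⇒OddExtremal hδ<h1+δ h1+δ<h2+δ {suc (suc m)} d {u₀} {u₁} δ≤d d₀ Δ<N u₁≢u₀ 1+δ≤d₁ weight≤ =
      size , u₀ , u₁ , u₁≢u₀ , d₀ , d₁ , others
      where
      hub-cancelled : h (d u₁) + sum (h ∘ d ∘ punchIn₂ u₁≢u₀) ≤ h (suc δ) + (Δ ∸ 1) · h δ
      hub-cancelled = +-cancelˡ-≤ (h Δ) (subst₂ _≤_ (weight-hub₂ d u₁≢u₀ d₀) oddBound-hub weight≤)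
      Δ∸1≤m = ℕₚ.∸-monoˡ-≤ 1 (ℕₚ.≤-pred Δ<N)
      split = +-mono-≤-tight (h-mono _ _ (s≤s z≤n) 1+δ≤d₁) (·≤sum 0≤hδ (hδ≤h ∘ δ≤d ∘ punchIn₂ u₁≢u₀) Δ∸1≤m)
                             hub-cancelled
      tight = ·≤sum-tight (h-pos δ 1≤δ) (hδ≤h ∘ δ≤d ∘ punchIn₂ u₁≢u₀) Δ∸1≤m (≤-reflexive (sym (proj₂ split)))
      size : suc (suc m) ≡ suc Δ
      size = cong suc (trans (cong suc (proj₁ tight)) (ℕₚ.m+[n∸m]≡n (ℕₚ.≤-trans 1≤δ δ≤Δ)))
      d₁ : d u₁ ≡ suc δ
      d₁ = h-tight h1+δ<h2+δ 1+δ≤d₁ (sym (proj₁ split))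
      others : ∀ v → v ≢ u₀ → v ≢ u₁ → d v ≡ δ
      others v v≢u₀ v≢u₁ with k , refl ← punchIn₂-onto u₁≢u₀ v≢u₀ v≢u₁ =
        h-tight hδ<h1+δ (δ≤d _) (proj₂ tight k)

    weight-EvenExtremal : ∀ {N} {d : Fin N → ℕ} → EvenExtremal δ Δ d → weight d ≡ evenBound
    weight-EvenExtremal even =
      trans (sum-EvenExtremal h even) (trans (cong (h Δ +_) (×ᴹ≡· Δ (h δ))) (sym evenBound-hub))

    weight-OddExtremal : ∀ {N} {d : Fin N → ℕ} → OddExtremal δ Δ d → weight d ≡ oddBound
    weight-OddExtremal odd =
      trans (sum-OddExtremal h odd) (trans (cong (λ x → h Δ + (h (suc δ) + x)) (×ᴹ≡· (Δ ∸ 1) (h δ))) (sym oddBound-hub))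

    even-weight : 2 ∣ Δ * suc δ → ∀ {N} {d : Fin N → ℕ} → Extremal δ Δ d → weight d ≡ evenBound
    even-weight _  (inj₁ (_ , even)) = weight-EvenExtremal even
    even-weight 2∣ (inj₂ (2∤ , _))   = ⊥-elim (2∤ 2∣)

    odd-weight : ¬ 2 ∣ Δ * suc δ → ∀ {N} {d : Fin N → ℕ} → Extremal δ Δ d → weight d ≡ oddBound
    odd-weight 2∤ (inj₁ (2∣ , _))  = ⊥-elim (2∤ 2∣)
    odd-weight _  (inj₂ (_ , odd)) = weight-OddExtremal odd

    Δ<n : ∀ Γ {u₀} → deg Γ u₀ ≡ Δ → Δ ℕ.< n Γ
    Δ<n Γ {u₀} d₀ = subst (ℕ._< n Γ) d₀ (deg<n Γ u₀)

    evenBound≤𝒥 : ∀ Γ → HasMinMax δ Δ Γ → evenBound ≤ 𝒥 R h Γ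
    evenBound≤𝒥 Γ (bounds , _ , u₀ , d₀) =
      subst (evenBound ≤_) (sym (𝒥≡weight Γ)) (evenBound≤weight (deg Γ) (proj₁ ∘ bounds) d₀ (Δ<n Γ d₀))

    oddBound≤𝒥 : ∀ Γ → HasMinMax δ Δ Γ → ¬ 2 ∣ Δ * suc δ → oddBound ≤ 𝒥 R h Γ
    oddBound≤𝒥 Γ (bounds , _ , u₀ , d₀) 2∤ =
      let u₁ , u₁≢u₀ , 1+δ≤d₁ = second-large-degree (deg Γ) (proj₁ ∘ bounds) d₀ (handshake Γ) 2∤
      in subst (oddBound ≤_) (sym (𝒥≡weight Γ)) (oddBound≤weight (deg Γ) (proj₁ ∘ bounds) d₀ (Δ<n Γ d₀) u₁≢u₀ 1+δ≤d₁)

    Extremal⇒Minimal : ∀ G → Extremal δ Δ (deg G) → Minimal R h δ Δ G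
    Extremal⇒Minimal G extremal = Extremal⇒HasMinMax G 1≤δ δ≤Δ extremal , minimal extremal
      where
      minimal : Extremal δ Δ (deg G) → ∀ Γ → HasMinMax δ Δ Γ → 𝒥 R h G ≤ 𝒥 R h Γ
      minimal (inj₁ (_ , even)) Γ Γ-bounds = begin
        𝒥 R h G         ≡⟨ 𝒥≡weight G ⟩
        weight (deg G)  ≡⟨ weight-EvenExtremal even ⟩
        evenBound       ≤⟨ evenBound≤𝒥 Γ Γ-bounds ⟩
        𝒥 R h Γ         ∎
      minimal (inj₂ (2∤ , odd)) Γ Γ-bounds = begin
        𝒥 R h G         ≡⟨ 𝒥≡weight G ⟩
        weight (deg G)  ≡⟨ weight-OddExtremal odd ⟩
        oddBound        ≤⟨ oddBound≤𝒥 Γ Γ-bounds 2∤ ⟩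
        𝒥 R h Γ         ∎

    Minimal⇒weight≤extremal : ∀ G → Minimal R h δ Δ G → weight (deg G) ≤ weight (deg Γ*)
    Minimal⇒weight≤extremal G (_ , minimal) =
      subst₂ _≤_ (𝒥≡weight G) (𝒥≡weight Γ*) (minimal Γ* (Extremal⇒HasMinMax Γ* 1≤δ δ≤Δ Γ*-extremal))

    Minimal⇒Extremal : (2 ∣ Δ * suc δ × h δ < h (suc δ))
                       ⊎ (¬ 2 ∣ Δ * suc δ × h δ < h (suc δ) × h (suc δ) < h (suc (suc δ))) →
                       ∀ G → Minimal R h δ Δ G → Extremal δ Δ (deg G)
    Minimal⇒Extremal (inj₁ (2∣ , hδ<h1+δ)) G G-minimal@((bounds , _ , u₀ , d₀) , _) =
      inj₁ (2∣ , weight≤evenBound⇒EvenExtremal hδ<h1+δ (deg G) (proj₁ ∘ bounds) d₀ (Δ<n G d₀)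
                   (subst (weight (deg G) ≤_) (even-weight 2∣ Γ*-extremal) (Minimal⇒weight≤extremal G G-minimal)))
    Minimal⇒Extremal (inj₂ (2∤ , hδ<h1+δ , h1+δ<h2+δ)) G G-minimal@((bounds , _ , u₀ , d₀) , _) =
      let u₁ , u₁≢u₀ , 1+δ≤d₁ = second-large-degree (deg G) (proj₁ ∘ bounds) d₀ (handshake G) 2∤
      in inj₂ (2∤ , weight≤oddBound⇒OddExtremal hδ<h1+δ h1+δ<h2+δ (deg G) (proj₁ ∘ bounds) d₀ (Δ<n G d₀) u₁≢u₀ 1+δ≤d₁
                      (subst (weight (deg G) ≤_) (odd-weight 2∤ Γ*-extremal) (Minimal⇒weight≤extremal G G-minimal)))

theorem2p5 : (R : OrderedAbelianGroup) → let open OrderedAbelianGroup R in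
    (δ Δ : ℕ) → 1 ℕ.≤ δ → δ ℕ.≤ Δ →
    (h : ℕ → Carrier) →
    (∀ k → 1 ℕ.≤ k → 0# < h k) →
    (∀ j k → 1 ℕ.≤ j → j ℕ.≤ k → h j ≤ h k) →
    (∀ G → InClass δ Δ G → Minimal R h δ Δ G)
    × (∀ Γ → HasMinMax δ Δ Γ →
         (2 ∣ Δ ℕ.* suc δ → Δ · h δ + h Δ ≤ 𝒥 R h Γ)
         × (¬ (2 ∣ Δ ℕ.* suc δ) →
              (Δ ∸ 1) · h δ + h (suc δ) + h Δ ≤ 𝒥 R h Γ))
    × (((2 ∣ Δ ℕ.* suc δ) × h δ < h (suc δ))
         ⊎ (¬ (2 ∣ Δ ℕ.* suc δ) × h δ < h (suc δ) × h (suc δ) < h (suc (suc δ))) →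
       ∀ G → HasMinMax δ Δ G → (Minimal R h δ Δ G ⇔ InClass δ Δ G))
theorem2p5 R δ Δ 1≤δ δ≤Δ h h-pos h-mono =
    (λ G → Extremal⇒Minimal G ∘ InClass⇒Extremal G)
  , (λ Γ Γ-bounds → (λ _ → evenBound≤𝒥 Γ Γ-bounds) , oddBound≤𝒥 Γ Γ-bounds)
  , λ strict G _ → mk⇔ (Extremal⇒InClass G 1≤δ δ≤Δ ∘ Minimal⇒Extremal strict G)
                       (Extremal⇒Minimal G ∘ InClass⇒Extremal G)
  where open WeightBounds R h h-pos h-mono 1≤δ δ≤Δ
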